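{- Let $t\ge 1$ be an integer and $n=2(t+1)^2$. For $0\le i\le t$, let $\mathcal{C}_i\subseteq\mathbb{Z}_n^2$ be the linear code with generator matrix \[ G_i=\begin{bmatrix} t+1+i & t+1-i\\ i & 2(t+1)-i\end{bmatrix}. \] Then every translate $\mathbf{x}+\mathcal{C}_i$ ($\mathbf{x}\in\mathbb{Z}_n^2$) is a $(2t+1)$-diameter perfect code with minimum distance $2t+2$ and anticode $\mathcal{A}_{2t+1}$.
   Context: $\mathbb{Z}_n$ is the ring of integers modulo $n$. The Lee weight of $\mathbf{u}=(u_1,u_2)\in\mathbb{Z}_n^2$ (entries represented in $\{0,\dots,n-1\}$) is $\mathrm{wt}_L(\mathbf{u})=\sum_{i=1}^2\min\{u_i,n-u_i\}$, and the Lee distance is $d_L(\mathbf{u},\mathbf{v})=\mathrm{wt}_L(\mathbf{u}-\mathbf{v})$; all distances are Lee distances. A code is a subset of $\mathbb{Z}_n^2$; it is linear if it is a $\mathbb{Z}_n$-submodule, and the code with a given generator matrix is the $\mathbb{Z}_n$-span of the rows. Its minimum distance is the minimum Lee distance between distinct codewords. The translate of a code $\mathcal{C}$ by $\mathbf{x}$ is $\mathbf{x}+\mathcal{C}=\{\mathbf{x}+\mathbf{c}:\mathbf{c}\in\mathcal{C}\}$. An anticode of diameter $D$ is a subset in which the maximum Lee distance between two elements is $D$. For an adjacent pair $\{p_1,p_2\}$ (Lee distance $1$), $\mathcal{A}_{2t+1}$ denotes the set of all points of $\mathbb{Z}_n^2$ whose Lee distance to $\{p_1,p_2\}$ (i.e.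 to $p_1$ or to $p_2$) is at most $t$; it is an anticode of diameter $2t+1$ of size $2(t+1)^2$, and $\{p_1,p_2\}$ is its core. A code $\mathcal{C}$ with minimum distance $d$ is a $D$-diameter perfect code with anticode $\mathcal{A}$ (where $\mathcal{A}$ is an anticode of diameter $D=d-1$) if $|\mathcal{C}|\cdot|\mathcal{A}|=|\mathbb{Z}_n^2|$. -}

module Defs where

open import Data.Nat using (ℕ; zero; suc; _+_; _*_; _∸_; _≤_; _⊓_; _≤ᵇ_; NonZero)
open import Data.Nat.DivMod using (_mod_)
open import Data.Fin using (Fin; toℕ)
open import Data.Fin.Properties using () renaming (_≟_ to _≟F_)
open import Data.Product using (_×_; _,_; ∃; ∃-syntax)
open import Data.Product.Properties using (≡-dec)
open import Data.Bool using (Bool; true; false; _∨_; _∧_; if_then_else_)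
open import Data.List using (List; map; allFin; cartesianProduct)
open import Data.Nat.ListAction using (sum)
open import Data.Bool.ListAction using (any)
open import Relation.Binary.PropositionalEquality using (_≡_; _≢_)
open import Relation.Nullary.Decidable using (⌊_⌋; Dec)

Pt : ℕ → Set
Pt n = Fin n × Fin n

_≟P_ : ∀ {n} (x y : Pt n) → Dec (x ≡ y)
_≟P_ = ≡-dec _≟F_ _≟F_

allPts : (n : ℕ) → List (Pt n)
allPts n = cartesianProduct (allFin n) (allFin n)

_⊕_ : ∀ {n} .{{_ : NonZero n}} → Pt n → Pt n → Pt n
_⊕_ {n} (a , b) (c , d) = ((toℕ a + toℕ c) mod n) , ((toℕ b + toℕ d) mod n)

_⊖_ : ∀ {n} .{{_ : NonZero n}} → Pt n → Pt n → Pt n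
_⊖_ {n} (a , b) (c , d) = ((toℕ a + (n ∸ toℕ c)) mod n) , ((toℕ b + (n ∸ toℕ d)) mod n)

leeEntry : ∀ {n} → Fin n → ℕ
leeEntry {n} u = toℕ u ⊓ (n ∸ toℕ u)

wtL : ∀ {n} → Pt n → ℕ
wtL (u₁ , u₂) = leeEntry u₁ + leeEntry u₂

dL : ∀ {n} .{{_ : NonZero n}} → Pt n → Pt n → ℕ
dL u v = wtL (u ⊖ v)

PtSet : ℕ → Set
PtSet n = Pt n → Bool

_∈_ : ∀ {n} → Pt n → PtSet n → Set
x ∈ S = S x ≡ true

card : ∀ {n} → PtSet n → ℕ
card {n} S = sum (map (λ x → if S x then 1 else 0) (allPts n))

-- Linear code (Z_n-span of the rows) of the 2×2 generator matrix
-- [ g₁₁ g₁₂ ; g₂₁ g₂₂ ] (entries given as naturals, read mod n).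
spanCode : ∀ {n} .{{_ : NonZero n}} → (g₁₁ g₁₂ g₂₁ g₂₂ : ℕ) → PtSet n
spanCode {n} g₁₁ g₁₂ g₂₁ g₂₂ y =
  any (λ ab → let a = toℕ (Data.Product.proj₁ ab) ; b = toℕ (Data.Product.proj₂ ab)
              in ⌊ y ≟P (((a * g₁₁ + b * g₂₁) mod n) , ((a * g₁₂ + b * g₂₂) mod n)) ⌋)
      (allPts n)

translate : ∀ {n} .{{_ : NonZero n}} → Pt n → PtSet n → PtSet n
translate {n} x C y = any (λ c → C c ∧ ⌊ y ≟P (x ⊕ c) ⌋) (allPts n)

MinDistance : ∀ {n} .{{_ : NonZero n}} → PtSet n → ℕ → Set
MinDistance C d =
  (∃[ x ] ∃[ y ] (x ∈ C × y ∈ C × x ≢ y × dL x y ≡ d)) ×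
  (∀ x y → x ∈ C → y ∈ C → x ≢ y → d ≤ dL x y)

IsAnticode : ∀ {n} .{{_ : NonZero n}} → PtSet n → ℕ → Set
IsAnticode A D =
  (∃[ x ] ∃[ y ] (x ∈ A × y ∈ A × dL x y ≡ D)) ×
  (∀ x y → x ∈ A → y ∈ A → dL x y ≤ D)

-- A_{2t+1} with core {p₁, p₂}: points at Lee distance ≤ t from p₁ or p₂.
Acore : ∀ {n} .{{_ : NonZero n}} → ℕ → Pt n → Pt n → PtSet n
Acore t p₁ p₂ y = (dL y p₁ ≤ᵇ t) ∨ (dL y p₂ ≤ᵇ t)

DiameterPerfect : ∀ {n} .{{_ : NonZero n}} → PtSet n → (D d : ℕ) → PtSet n → Set
DiameterPerfect {n} C D d A =
  MinDistance C d × D ≡ d ∸ 1 × IsAnticode A D × card C * card A ≡ n * n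

nOf : ℕ → ℕ
nOf t = 2 * (suc t * suc t)

Ccode : (t i : ℕ) → PtSet (nOf t)
Ccode t i = spanCode (suc t + i) (suc t ∸ i) i (2 * suc t ∸ i)

module Submission where

-- Lift everything to ℤ². With s = t + 1, the translate x + C_i lifts to x + Λ, where
-- Λ = {(α(s + i) - βs, α(s - i) + βs)} is the integer span of the rows of G_i; it contains nℤ²,
-- and the Lee distance of two points is the least ℓ₁-norm of an integer vector congruent to
-- their difference. In the rotated coordinates (a + b, b - a) the ℓ₁-norm becomes the sup norm
-- and Λ becomes {(2sα, 2sβ - 2iα)}. Hence a nonzero vector of Λ has norm at least 2s = 2t + 2,
-- and, choosing α and then β by division with remainder, every integer vector lies within t of
-- Λ or of Λ + e, for any prescribed unit vector e. With e = p₂ - p₁ this writes every point as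
-- c + a with c a codeword and a ∈ A_{2t+1}, uniquely because A_{2t+1} has diameter
-- 2t + 1 < 2t + 2; counting the pairs (c, a) gives |C|·|A_{2t+1}| = n².

open import Data.Nat using (ℕ; NonZero; _≤_)
open import Relation.Binary.PropositionalEquality using (_≡_)
open import Defs

module FiniteSums where

  open import Data.Nat using (ℕ; zero; suc; _+_; _*_)
  open import Data.Nat.Properties using (+-identityʳ; *-zeroʳ; *-identityʳ; *-distribˡ-+; *-distribʳ-+)
  open import Data.Nat.ListAction using (sum)
  open import Data.Nat.ListAction.Properties using (sum-++)
  open import Data.Nat.Tactic.RingSolver using (solve-∀)
  open import Data.List using (List; []; _∷_; _++_; map; length; allFin; cartesianProduct)
  open import Data.List.Properties using (map-cong; map-++; map-∘; map-tabulate; length-tabulate)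
  open import Data.Fin using (Fin; zero; suc)
  open import Data.Fin.Properties using (suc-injective)
  open import Data.Product using (_×_; _,_; proj₁; proj₂)
  open import Data.Bool using (if_then_else_)
  open import Relation.Nullary.Decidable using (does; dec-true; dec-false)
  open import Function using (_∘_; id)
  open import Relation.Binary.PropositionalEquality
  open import Relation.Nullary using (¬_)
  open ≡-Reasoning

  ∑ : {A : Set} → List A → (A → ℕ) → ℕ
  ∑ xs f = sum (map f xs)

  module _ {A : Set} where

    ∑-cong : ∀ (xs : List A) {f g : A → ℕ} → (∀ x → f x ≡ g x) → ∑ xs f ≡ ∑ xs g
    ∑-cong xs f≗g = cong sum (map-cong f≗g xs)

    ∑-const : ∀ (xs : List A) k → ∑ xs (λ _ → k) ≡ length xs * k
    ∑-const []       k = refl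
    ∑-const (x ∷ xs) k = cong (k +_) (∑-const xs k)

    ∑-zero : ∀ (xs : List A) {f : A → ℕ} → (∀ x → f x ≡ 0) → ∑ xs f ≡ 0
    ∑-zero xs f≡0 = trans (∑-cong xs f≡0) (trans (∑-const xs 0) (*-zeroʳ (length xs)))

    ∑-+ : ∀ (xs : List A) (f g : A → ℕ) → ∑ xs (λ x → f x + g x) ≡ ∑ xs f + ∑ xs g
    ∑-+ []       f g = refl
    ∑-+ (x ∷ xs) f g = begin
      f x + g x + ∑ xs (λ x → f x + g x) ≡⟨ cong (f x + g x +_) (∑-+ xs f g) ⟩
      f x + g x + (∑ xs f + ∑ xs g)      ≡⟨ interchange (f x) (g x) (∑ xs f) (∑ xs g) ⟩
      f x + ∑ xs f + (g x + ∑ xs g)      ∎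
      where
      interchange : ∀ a b c d → a + b + (c + d) ≡ a + c + (b + d)
      interchange = solve-∀

    ∑-*ˡ : ∀ (xs : List A) m (f : A → ℕ) → m * ∑ xs f ≡ ∑ xs (λ x → m * f x)
    ∑-*ˡ []       m f = *-zeroʳ m
    ∑-*ˡ (x ∷ xs) m f = trans (*-distribˡ-+ m (f x) (∑ xs f)) (cong (m * f x +_) (∑-*ˡ xs m f))

    ∑-*ʳ : ∀ (xs : List A) m (f : A → ℕ) → ∑ xs f * m ≡ ∑ xs (λ x → f x * m)
    ∑-*ʳ []       m f = refl
    ∑-*ʳ (x ∷ xs) m f = trans (*-distribʳ-+ m (f x) (∑ xs f)) (cong (f x * m +_) (∑-*ʳ xs m f))

    ∑-++ : ∀ (xs ys : List A) (f : A → ℕ) → ∑ (xs ++ ys) f ≡ ∑ xs f + ∑ ys f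
    ∑-++ xs ys f = trans (cong sum (map-++ f xs ys)) (sum-++ (map f xs) (map f ys))

  ∑-map : {A B : Set} (g : A → B) (xs : List A) (f : B → ℕ) → ∑ (map g xs) f ≡ ∑ xs (f ∘ g)
  ∑-map g xs f = cong sum (sym (map-∘ xs))

  module _ {A B : Set} where

    ∑-comm : ∀ (xs : List A) (ys : List B) (f : A → B → ℕ) →
             ∑ xs (λ x → ∑ ys (f x)) ≡ ∑ ys (λ y → ∑ xs (λ x → f x y))
    ∑-comm []       ys f = sym (∑-zero ys (λ _ → refl))
    ∑-comm (x ∷ xs) ys f = trans (cong (∑ ys (f x) +_) (∑-comm xs ys f))
                                 (sym (∑-+ ys (f x) (λ y → ∑ xs (λ x → f x y))))

    ∑-cartesianProduct : ∀ (xs : List A) (ys : List B) (f : A × B → ℕ) →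
                         ∑ (cartesianProduct xs ys) f ≡ ∑ xs (λ x → ∑ ys (λ y → f (x , y)))
    ∑-cartesianProduct []       ys f = refl
    ∑-cartesianProduct (x ∷ xs) ys f = begin
      ∑ (map (x ,_) ys ++ cartesianProduct xs ys) f          ≡⟨ ∑-++ (map (x ,_) ys) _ f ⟩
      ∑ (map (x ,_) ys) f + ∑ (cartesianProduct xs ys) f     ≡⟨ cong₂ _+_ (∑-map (x ,_) ys f) (∑-cartesianProduct xs ys f) ⟩
      ∑ ys (λ y → f (x , y)) + ∑ xs (λ x → ∑ ys (λ y → f (x , y))) ∎

  ∑-allFin-suc : ∀ n (f : Fin (suc n) → ℕ) → ∑ (allFin (suc n)) f ≡ f zero + ∑ (allFin n) (f ∘ suc)
  ∑-allFin-suc n f = cong (λ xs → f zero + sum xs) (trans (map-tabulate suc f) (sym (map-tabulate id (f ∘ suc))))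

  ∑-allFin-δ : ∀ n (f : Fin n → ℕ) a → (∀ b → ¬ b ≡ a → f b ≡ 0) → ∑ (allFin n) f ≡ f a
  ∑-allFin-δ (suc n) f zero    f≡0 = begin
    ∑ (allFin (suc n)) f          ≡⟨ ∑-allFin-suc n f ⟩
    f zero + ∑ (allFin n) (f ∘ suc) ≡⟨ cong (f zero +_) (∑-zero (allFin n) (λ b → f≡0 (suc b) λ ())) ⟩
    f zero + 0                     ≡⟨ +-identityʳ (f zero) ⟩
    f zero                         ∎
  ∑-allFin-δ (suc n) f (suc a) f≡0 = begin
    ∑ (allFin (suc n)) f          ≡⟨ ∑-allFin-suc n f ⟩
    f zero + ∑ (allFin n) (f ∘ suc) ≡⟨ cong₂ _+_ (f≡0 zero λ ()) (∑-allFin-δ n (f ∘ suc) a off-a) ⟩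
    f (suc a)                      ∎
    where
    off-a : ∀ b → ¬ b ≡ a → f (suc b) ≡ 0
    off-a b b≢a = f≡0 (suc b) (b≢a ∘ suc-injective)

  length-allFin : ∀ n → length (allFin n) ≡ n
  length-allFin n = length-tabulate id

  ∑-allPts-δ : ∀ n (f : Pt n → ℕ) p → (∀ q → ¬ q ≡ p → f q ≡ 0) → ∑ (allPts n) f ≡ f p
  ∑-allPts-δ n f (a , b) f≡0 = begin
    ∑ (allPts n) f                                      ≡⟨ ∑-cartesianProduct (allFin n) (allFin n) f ⟩
    ∑ (allFin n) (λ a′ → ∑ (allFin n) (λ b′ → f (a′ , b′))) ≡⟨ ∑-allFin-δ n _ a off-row ⟩
    ∑ (allFin n) (λ b′ → f (a , b′))                     ≡⟨ ∑-allFin-δ n _ b (λ b′ b′≢b → f≡0 _ (b′≢b ∘ cong proj₂)) ⟩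
    f (a , b)                                           ∎
    where
    off-row : ∀ a′ → ¬ a′ ≡ a → ∑ (allFin n) (λ b′ → f (a′ , b′)) ≡ 0
    off-row a′ a′≢a = ∑-zero (allFin n) (λ b′ → f≡0 _ (a′≢a ∘ cong proj₁))

  ∑-allPts-1 : ∀ n → ∑ (allPts n) (λ _ → 1) ≡ n * n
  ∑-allPts-1 n = begin
    ∑ (allPts n) (λ _ → 1)                      ≡⟨ ∑-cartesianProduct (allFin n) (allFin n) _ ⟩
    ∑ (allFin n) (λ _ → ∑ (allFin n) (λ _ → 1)) ≡⟨ ∑-const (allFin n) _ ⟩
    length (allFin n) * ∑ (allFin n) (λ _ → 1)  ≡⟨ cong₂ _*_ (length-allFin n) row ⟩
    n * n                                       ∎
    where
    row : ∑ (allFin n) (λ _ → 1) ≡ n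
    row = trans (∑-const (allFin n) 1) (trans (*-identityʳ _) (length-allFin n))

  ∑-allPts-reindex : ∀ n (g h : Pt n → Pt n) → (∀ p → h (g p) ≡ p) → (∀ q → g (h q) ≡ q) →
                     ∀ f → ∑ (allPts n) f ≡ ∑ (allPts n) (f ∘ h)
  ∑-allPts-reindex n g h hg≗id gh≗id f = begin
    ∑ P f                          ≡⟨ ∑-cong P (λ p → sym (column p)) ⟩
    ∑ P (λ p → ∑ P (λ q → δ q p))  ≡⟨ ∑-comm P P (λ p q → δ q p) ⟩
    ∑ P (λ q → ∑ P (λ p → δ q p))  ≡⟨ ∑-cong P row ⟩
    ∑ P (f ∘ h)                    ∎
    where
    P : List (Pt n)
    P = allPts n
    δ : Pt n → Pt n → ℕ
    δ q p = if does (q ≟P g p) then f p else 0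
    δ-on : ∀ {q p} → q ≡ g p → δ q p ≡ f p
    δ-on {q} {p} e = cong (λ b → if b then f p else 0) (dec-true (q ≟P g p) e)
    δ-off : ∀ {q p} → ¬ q ≡ g p → δ q p ≡ 0
    δ-off {q} {p} ne = cong (λ b → if b then f p else 0) (dec-false (q ≟P g p) ne)
    column : ∀ p → ∑ P (λ q → δ q p) ≡ f p
    column p = trans (∑-allPts-δ n _ (g p) (λ q → δ-off)) (δ-on refl)
    row : ∀ q → ∑ P (λ p → δ q p) ≡ f (h q)
    row q = trans (∑-allPts-δ n _ (h q) (λ p p≢hq → δ-off λ e → p≢hq (trans (sym (hg≗id p)) (cong h (sym e)))))
                  (δ-on (sym (gh≗id q)))

module IntegerFacts where

  open import Data.Nat as ℕ using (ℕ; zero; suc; z≤n; s≤s)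
  import Data.Nat.Properties as ℕ
  open import Data.Integer using (ℤ; +_; +[1+_]; -[1+_]; _+_; _-_; _*_; ∣_∣; 0ℤ; 1ℤ)
  open import Data.Integer.Properties
  open import Data.Integer.DivMod using (_/ℕ_; _%ℕ_; n%ℕd<d; a≡a%ℕn+[a/ℕn]*n)
  open import Data.Integer.Tactic.RingSolver using (solve-∀)
  open import Data.Product using (_×_; _,_; ∃-syntax)
  open import Data.Sum using (_⊎_; inj₁; inj₂)
  import Data.Sum as Sum
  open import Relation.Binary.PropositionalEquality
  open import Relation.Nullary using (yes; no; contradiction)
  open ≡-Reasoning

  k≡0⊎d≤∣k*d∣ : ∀ k d → k ≡ 0ℤ ⊎ d ℕ.≤ ∣ k * + d ∣
  k≡0⊎d≤∣k*d∣ k d =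
    Sum.map ∣i∣≡0⇒i≡0 (subst (d ℕ.≤_) (sym (∣i*j∣≡∣i∣*∣j∣ k (+ d)))) (m≡0⊎d≤m*d ∣ k ∣)
    where
    m≡0⊎d≤m*d : ∀ m → m ≡ 0 ⊎ d ℕ.≤ m ℕ.* d
    m≡0⊎d≤m*d zero    = inj₁ refl
    m≡0⊎d≤m*d (suc m) = inj₂ (ℕ.m≤m+n d (m ℕ.* d))

  ∣k*d∣<d⇒k≡0 : ∀ k d → ∣ k * + d ∣ ℕ.< d → k ≡ 0ℤ
  ∣k*d∣<d⇒k≡0 k d ∣k*d∣<d with k≡0⊎d≤∣k*d∣ k d
  ... | inj₁ k≡0   = k≡0
  ... | inj₂ d≤∣k*d∣ = contradiction d≤∣k*d∣ (ℕ.<⇒≱ ∣k*d∣<d)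

  -- The ℓ₁ norm is the sup norm in the rotated coordinates (a + b, b - a).
  ∣a∣+∣b∣≡∣a+b∣⊎∣b-a∣ : ∀ a b → ∣ a ∣ ℕ.+ ∣ b ∣ ≡ ∣ a + b ∣ ⊎ ∣ a ∣ ℕ.+ ∣ b ∣ ≡ ∣ b - a ∣
  ∣a∣+∣b∣≡∣a+b∣⊎∣b-a∣ (+ a)    (+ b)    = inj₁ refl
  ∣a∣+∣b∣≡∣a+b∣⊎∣b-a∣ (+ a)    -[1+ b ] = inj₂ (trans (ℕ.+-suc a b) (cong ∣_∣ (sym (neg-minus-pos b a))))
  ∣a∣+∣b∣≡∣a+b∣⊎∣b-a∣ -[1+ a ] (+ b)    = inj₂ (ℕ.+-comm (suc a) b)
  ∣a∣+∣b∣≡∣a+b∣⊎∣b-a∣ -[1+ a ] -[1+ b ] = inj₁ (cong suc (ℕ.+-suc a b))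

  +[m∸n]≡+m-+n : ∀ {m n} → n ℕ.≤ m → + (m ℕ.∸ n) ≡ + m - + n
  +[m∸n]≡+m-+n {m} {n} n≤m = trans (sym (⊖-≥ n≤m)) (sym (m-n≡m⊖n m n))

  ρ≤t+t⇒∣ρ-t∣≤t : ∀ {ρ} t → ρ ℕ.≤ t ℕ.+ t → ∣ + ρ - + t ∣ ℕ.≤ t
  ρ≤t+t⇒∣ρ-t∣≤t {ρ} t ρ≤t+t rewrite [+m]-[+n]≡m⊖n ρ t with ρ ℕ.≤? t
  ... | yes ρ≤t = subst (ℕ._≤ t) (sym (∣⊖∣-≤ ρ≤t)) (ℕ.m∸n≤m t ρ)
  ... | no  ρ≰t = subst (ℕ._≤ t) (cong ∣_∣ (sym (⊖-≥ (ℕ.≰⇒≥ ρ≰t)))) (ℕ.m≤n+o⇒m∸n≤o ρ t ρ≤t+t)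

  window : ∀ t z → ∃[ q ] ∃[ ρ ] ρ ℕ.< suc t ℕ.+ suc t × z - q * + (suc t ℕ.+ suc t) ≡ + ρ - + t
  window t z = q , ρ , n%ℕd<d (z + + t) d , (begin
    z - q * + d                   ≡⟨ add-t z (+ t) (q * + d) ⟩
    (z + + t) - q * + d - + t     ≡⟨ cong (λ x → x - q * + d - + t) (a≡a%ℕn+[a/ℕn]*n (z + + t) d) ⟩
    + ρ + q * + d - q * + d - + t ≡⟨ cancel (+ ρ) (q * + d) (+ t) ⟩
    + ρ - + t                     ∎)
    where
    d : ℕ
    d = suc t ℕ.+ suc t
    q : ℤ
    q = (z + + t) /ℕ d
    ρ : ℕ
    ρ = (z + + t) %ℕ d
    add-t : ∀ z t x → z - x ≡ (z + t) - x - t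
    add-t = solve-∀
    cancel : ∀ r x t → r + x - x - t ≡ r - t
    cancel = solve-∀

  x+x≢1 : ∀ x → x + x ≢ 1ℤ
  x+x≢1 (+ zero) ()
  x+x≢1 +[1+ m ] eq = ℕ.m+1+n≢0 m (ℕ.suc-injective (+-injective eq))
  x+x≢1 -[1+ m ] ()

  private
    ≤t+t⊎≡top : ∀ {t ρ} → ρ ℕ.< suc t ℕ.+ suc t → ρ ℕ.≤ t ℕ.+ t ⊎ ρ ≡ suc (t ℕ.+ t)
    ≤t+t⊎≡top {t} {ρ} ρ<2s with ρ ℕ.≤? t ℕ.+ t
    ... | yes ρ≤t+t = inj₁ ρ≤t+t
    ... | no  ρ≰t+t = inj₂ (ℕ.≤-antisym (ℕ.≤-pred (subst (ρ ℕ.<_) (cong suc (ℕ.+-suc t t)) ρ<2s)) (ℕ.≰⇒> ρ≰t+t))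

    1≤ρ⇒∣ρ-t-1∣≤t : ∀ {t ρ} → 1 ℕ.≤ ρ → ρ ℕ.< suc t ℕ.+ suc t → ∣ + ρ - + t - 1ℤ ∣ ℕ.≤ t
    1≤ρ⇒∣ρ-t-1∣≤t {t} {suc ρ} _ ρ<2s = subst (λ x → ∣ x ∣ ℕ.≤ t) (sym (drop-1 (+ ρ) (+ t)))
      (ρ≤t+t⇒∣ρ-t∣≤t t (ℕ.≤-pred (subst (suc ρ ℕ.≤_) (ℕ.+-suc t t) (ℕ.≤-pred ρ<2s))))
      where
      drop-1 : ∀ r t → 1ℤ + r - t - 1ℤ ≡ r - t
      drop-1 = solve-∀

    top-partner-pos : ∀ {t ρ} b → (+ suc (t ℕ.+ t) - + t) + (+ ρ - + t) ≡ b + b → 1 ℕ.≤ ρ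
    top-partner-pos {t} {zero}  b eq = contradiction (trans (sym eq) (sum-is-1 (+ t))) (x+x≢1 b)
      where
      sum-is-1 : ∀ t → (1ℤ + (t + t) - t) + (0ℤ - t) ≡ 1ℤ
      sum-is-1 = solve-∀
    top-partner-pos {t} {suc ρ} b eq = s≤s z≤n

  window-pair : ∀ t {ρ ρ′} b → ρ ℕ.< suc t ℕ.+ suc t → ρ′ ℕ.< suc t ℕ.+ suc t →
                (+ ρ - + t) + (+ ρ′ - + t) ≡ b + b →
                (∣ + ρ - + t ∣ ℕ.≤ t × ∣ + ρ′ - + t ∣ ℕ.≤ t) ⊎
                (∣ + ρ - + t - 1ℤ ∣ ℕ.≤ t × ∣ + ρ′ - + t - 1ℤ ∣ ℕ.≤ t)
  window-pair t {ρ} {ρ′} b ρ<2s ρ′<2s P+Q≡b+b with ≤t+t⊎≡top ρ<2s | ≤t+t⊎≡top ρ′<2s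
  ... | inj₁ ρ≤t+t | inj₁ ρ′≤t+t = inj₁ (ρ≤t+t⇒∣ρ-t∣≤t t ρ≤t+t , ρ≤t+t⇒∣ρ-t∣≤t t ρ′≤t+t)
  ... | inj₂ refl  | _           = inj₂ (1≤ρ⇒∣ρ-t-1∣≤t (s≤s z≤n) ρ<2s ,
                                        1≤ρ⇒∣ρ-t-1∣≤t (top-partner-pos {t} b P+Q≡b+b) ρ′<2s)
  ... | inj₁ _     | inj₂ refl   = inj₂ (1≤ρ⇒∣ρ-t-1∣≤t (top-partner-pos {t} b Q+P≡b+b) ρ<2s ,
                                        1≤ρ⇒∣ρ-t-1∣≤t (s≤s z≤n) ρ′<2s)
    where
    Q+P≡b+b : (+ suc (t ℕ.+ t) - + t) + (+ ρ - + t) ≡ b + b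
    Q+P≡b+b = trans (+-comm (+ suc (t ℕ.+ t) - + t) (+ ρ - + t)) P+Q≡b+b

open IntegerFacts

module IntegerVectors where

  open import Data.Nat as ℕ using (ℕ)
  import Data.Nat.Properties as ℕ
  open import Data.Integer using (ℤ; _+_; _-_; -_; _*_; ∣_∣)
  open import Data.Integer.Properties using (∣-i∣≡∣i∣; ∣i+j∣≤∣i∣+∣j∣; ∣i-j∣≤∣i∣+∣j∣; ∣i*j∣≡∣i∣*∣j∣)
  open import Data.Product using (_×_; _,_; proj₁; proj₂)
  open import Data.Sum using (inj₁; inj₂)
  open import Relation.Binary.PropositionalEquality

  ℤ² : Set
  ℤ² = ℤ × ℤ

  infixl 6 _+ᵥ_ _-ᵥ_

  _+ᵥ_ _-ᵥ_ : ℤ² → ℤ² → ℤ²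
  v +ᵥ w = proj₁ v + proj₁ w , proj₂ v + proj₂ w
  v -ᵥ w = proj₁ v - proj₁ w , proj₂ v - proj₂ w

  -ᵥ_ : ℤ² → ℤ²
  -ᵥ v = - proj₁ v , - proj₂ v

  infixr 7 _*ᵥ_

  _*ᵥ_ : ℤ → ℤ² → ℤ²
  k *ᵥ v = k * proj₁ v , k * proj₂ v

  swap : ℤ² → ℤ²
  swap v = proj₂ v , proj₁ v

  ‖_‖ : ℤ² → ℕ
  ‖ v ‖ = ∣ proj₁ v ∣ ℕ.+ ∣ proj₂ v ∣

  ‖-ᵥ‖ : ∀ v → ‖ -ᵥ v ‖ ≡ ‖ v ‖
  ‖-ᵥ‖ v = cong₂ ℕ._+_ (∣-i∣≡∣i∣ (proj₁ v)) (∣-i∣≡∣i∣ (proj₂ v))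

  ‖swap‖ : ∀ v → ‖ swap v ‖ ≡ ‖ v ‖
  ‖swap‖ v = ℕ.+-comm (∣ proj₂ v ∣) (∣ proj₁ v ∣)

  ‖+ᵥ‖≤ : ∀ v w → ‖ v +ᵥ w ‖ ℕ.≤ ‖ v ‖ ℕ.+ ‖ w ‖
  ‖+ᵥ‖≤ (a , b) (c , d) = ℕ.≤-trans (ℕ.+-mono-≤ (∣i+j∣≤∣i∣+∣j∣ a c) (∣i+j∣≤∣i∣+∣j∣ b d))
                                    (ℕ.≤-reflexive (interchange (∣ a ∣) (∣ c ∣) (∣ b ∣) (∣ d ∣)))
    where
    interchange : ∀ a c b d → a ℕ.+ c ℕ.+ (b ℕ.+ d) ≡ a ℕ.+ b ℕ.+ (c ℕ.+ d)
    interchange = NatSolver.solve-∀ where import Data.Nat.Tactic.RingSolver as NatSolver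

  ‖*ᵥ‖ : ∀ k v → ‖ k *ᵥ v ‖ ≡ ∣ k ∣ ℕ.* ‖ v ‖
  ‖*ᵥ‖ k (a , b) = trans (cong₂ ℕ._+_ (∣i*j∣≡∣i∣*∣j∣ k a) (∣i*j∣≡∣i∣*∣j∣ k b))
                          (sym (ℕ.*-distribˡ-+ (∣ k ∣) (∣ a ∣) (∣ b ∣)))

  ∣v₁+v₂∣≤‖v‖ : ∀ v → ∣ proj₁ v + proj₂ v ∣ ℕ.≤ ‖ v ‖
  ∣v₁+v₂∣≤‖v‖ v = ∣i+j∣≤∣i∣+∣j∣ (proj₁ v) (proj₂ v)

  ∣v₂-v₁∣≤‖v‖ : ∀ v → ∣ proj₂ v - proj₁ v ∣ ℕ.≤ ‖ v ‖
  ∣v₂-v₁∣≤‖v‖ v = subst (∣ proj₂ v - proj₁ v ∣ ℕ.≤_) (ℕ.+-comm (∣ proj₂ v ∣) (∣ proj₁ v ∣))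
                        (∣i-j∣≤∣i∣+∣j∣ (proj₂ v) (proj₁ v))

  ‖‖≤-rotated : ∀ t v → ∣ proj₁ v + proj₂ v ∣ ℕ.≤ t → ∣ proj₂ v - proj₁ v ∣ ℕ.≤ t → ‖ v ‖ ℕ.≤ t
  ‖‖≤-rotated t (a , b) ∣a+b∣≤t ∣b-a∣≤t with ∣a∣+∣b∣≡∣a+b∣⊎∣b-a∣ a b
  ... | inj₁ eq = subst (ℕ._≤ t) (sym eq) ∣a+b∣≤t
  ... | inj₂ eq = subst (ℕ._≤ t) (sym eq) ∣b-a∣≤t

open IntegerVectors

module Congruence (n : ℕ) where

  open import Data.Integer using (ℤ; +_; _+_; _-_; -_; _*_; 0ℤ)
  open import Data.Integer.Properties using (+-inverseʳ; *-zeroˡ; +-identityˡ)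
  open import Data.Integer.Divisibility.Signed using (_∣_; divides; ∣m∣n⇒∣m+n; ∣m⇒∣-m; ∣n⇒∣m*n)
  open import Data.Integer.Tactic.RingSolver using (solve-∀)
  open import Data.Product using (_,_; proj₁; proj₂)
  open import Relation.Binary.Bundles using (Setoid)
  import Relation.Binary.Reasoning.Setoid as SetoidReasoning
  open import Relation.Binary.PropositionalEquality using (_≡_; refl; sym; trans)

  infix 4 _≈_ _≈ᵥ_

  -- Records rather than synonyms (also _≈ᵥ_ below), so that the compared integers can be
  -- inferred from a proof.
  record _≈_ (a b : ℤ) : Set where
    constructor ∣-diff
    field n∣a-b : + n ∣ a - b

  private
    by : ∀ {x a b} → x ≡ a - b → + n ∣ x → a ≈ b
    by refl n∣x = ∣-diff n∣x

  ≈-refl : ∀ {a} → a ≈ a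
  ≈-refl {a} = ∣-diff (divides 0ℤ (trans (+-inverseʳ a) (sym (*-zeroˡ (+ n)))))

  ≈-reflexive : ∀ {a b} → a ≡ b → a ≈ b
  ≈-reflexive refl = ≈-refl

  ≈-sym : ∀ {a b} → a ≈ b → b ≈ a
  ≈-sym {a} {b} (∣-diff n∣a-b) = by (identity a b) (∣m⇒∣-m n∣a-b)
    where
    identity : ∀ a b → - (a - b) ≡ b - a
    identity = solve-∀

  ≈-trans : ∀ {a b c} → a ≈ b → b ≈ c → a ≈ c
  ≈-trans {a} {b} {c} (∣-diff n∣a-b) (∣-diff n∣b-c) = by (identity a b c) (∣m∣n⇒∣m+n n∣a-b n∣b-c)
    where
    identity : ∀ a b c → (a - b) + (b - c) ≡ a - c
    identity = solve-∀

  ≈-+ : ∀ {a b c d} → a ≈ b → c ≈ d → a + c ≈ b + d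
  ≈-+ {a} {b} {c} {d} (∣-diff n∣a-b) (∣-diff n∣c-d) = by (identity a b c d) (∣m∣n⇒∣m+n n∣a-b n∣c-d)
    where
    identity : ∀ a b c d → (a - b) + (c - d) ≡ (a + c) - (b + d)
    identity = solve-∀

  ≈-neg : ∀ {a b} → a ≈ b → - a ≈ - b
  ≈-neg {a} {b} (∣-diff n∣a-b) = by (identity a b) (∣m⇒∣-m n∣a-b)
    where
    identity : ∀ a b → - (a - b) ≡ - a - - b
    identity = solve-∀

  ≈-- : ∀ {a b c d} → a ≈ b → c ≈ d → a - c ≈ b - d
  ≈-- a≈b c≈d = ≈-+ a≈b (≈-neg c≈d)

  ≈-*ʳ : ∀ {a b} k → a ≈ b → a * k ≈ b * k
  ≈-*ʳ {a} {b} k (∣-diff n∣a-b) = by (identity a b k) (∣n⇒∣m*n k n∣a-b)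
    where
    identity : ∀ a b k → k * (a - b) ≡ a * k - b * k
    identity = solve-∀

  ≈-+multiple : ∀ a k → a + k * + n ≈ a
  ≈-+multiple a k = ∣-diff (divides k (identity a k (+ n)))
    where
    identity : ∀ a k n → a + k * n - a ≡ k * n
    identity = solve-∀

  record _≈ᵥ_ (v w : ℤ²) : Set where
    constructor _,_
    field
      ≈₁ : proj₁ v ≈ proj₁ w
      ≈₂ : proj₂ v ≈ proj₂ w
  open _≈ᵥ_ public

  ≈ᵥ-refl : ∀ {v} → v ≈ᵥ v
  ≈ᵥ-refl = ≈-refl , ≈-refl

  ≈ᵥ-sym : ∀ {v w} → v ≈ᵥ w → w ≈ᵥ v
  ≈ᵥ-sym (p₁ , p₂) = ≈-sym p₁ , ≈-sym p₂

  ≈ᵥ-trans : ∀ {u v w} → u ≈ᵥ v → v ≈ᵥ w → u ≈ᵥ w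
  ≈ᵥ-trans (p₁ , p₂) (q₁ , q₂) = ≈-trans p₁ q₁ , ≈-trans p₂ q₂

  ≈ᵥ-setoid : Setoid _ _
  ≈ᵥ-setoid = record
    { Carrier       = ℤ²
    ; _≈_           = _≈ᵥ_
    ; isEquivalence = record { refl = ≈ᵥ-refl ; sym = ≈ᵥ-sym ; trans = ≈ᵥ-trans }
    }

  ≈ᵥ-0⇒≈ᵥ : ∀ {v w} → (0ℤ , 0ℤ) ≈ᵥ v -ᵥ w → v ≈ᵥ w
  ≈ᵥ-0⇒≈ᵥ {v} {w} (0≈₁ , 0≈₂) = 0≈a-b⇒a≈b 0≈₁ , 0≈a-b⇒a≈b 0≈₂
    where
    0≈a-b⇒a≈b : ∀ {a b} → 0ℤ ≈ a - b → a ≈ b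
    0≈a-b⇒a≈b {a} {b} 0≈a-b =
      ≈-trans (≈-reflexive (identity a b)) (≈-trans (≈-+ (≈-sym 0≈a-b) (≈-refl {b})) (≈-reflexive (+-identityˡ b)))
      where
      identity : ∀ a b → a ≡ a - b + b
      identity = solve-∀

  ≈ᵥ-+ᵥ : ∀ {v v′ w w′} → v ≈ᵥ v′ → w ≈ᵥ w′ → v +ᵥ w ≈ᵥ v′ +ᵥ w′
  ≈ᵥ-+ᵥ (p₁ , p₂) (q₁ , q₂) = ≈-+ p₁ q₁ , ≈-+ p₂ q₂

  ≈ᵥ--ᵥ : ∀ {v v′ w w′} → v ≈ᵥ v′ → w ≈ᵥ w′ → v -ᵥ w ≈ᵥ v′ -ᵥ w′
  ≈ᵥ--ᵥ (p₁ , p₂) (q₁ , q₂) = ≈-- p₁ q₁ , ≈-- p₂ q₂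

  module ≈ᵥ-Reasoning = SetoidReasoning ≈ᵥ-setoid

module Residues (n : ℕ) .{{_ : NonZero n}} where

  open import Data.Nat as ℕ using (_≤_; _<_; _∸_)
  import Data.Nat.Properties as ℕ
  open import Data.Nat.DivMod using (_mod_; _/_; m≡m%n+[m/n]*n; m%n<n)
  open import Data.Integer using (ℤ; +_; _+_; _-_; -_; _*_; ∣_∣; 0ℤ; 1ℤ; -1ℤ)
  open import Data.Integer.Properties
  open import Data.Integer.DivMod using (_/ℕ_; n%ℕd<d; a≡a%ℕn+[a/ℕn]*n)
  open import Data.Integer.Divisibility.Signed using (divides)
  open import Data.Integer.Tactic.RingSolver using (solve-∀)
  open import Data.Fin using (Fin; toℕ; fromℕ<)
  open import Data.Fin.Properties using (toℕ-fromℕ<; toℕ<n; toℕ-injective)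
  open import Data.Product using (_×_; _,_; proj₁; proj₂; ∃-syntax)
  open import Data.Sum using (inj₁; inj₂)
  open import Relation.Binary.PropositionalEquality
  open import Relation.Nullary using (yes; no)
  open Congruence n

  ⟦_⟧ : Fin n → ℤ
  ⟦ a ⟧ = + toℕ a

  lift : Pt n → ℤ²
  lift p = ⟦ proj₁ p ⟧ , ⟦ proj₂ p ⟧

  ⟦mod⟧ : ∀ m → ⟦ m mod n ⟧ ≈ + m
  ⟦mod⟧ m = ≈-sym (subst (_≈ ⟦ m mod n ⟧) (sym +m≡) (≈-+multiple ⟦ m mod n ⟧ (+ (m / n))))
    where
    +m≡ : + m ≡ ⟦ m mod n ⟧ + + (m / n) * + n
    +m≡ = trans (cong +_ (trans (m≡m%n+[m/n]*n m n) (cong (ℕ._+ m / n ℕ.* n) (sym (toℕ-fromℕ< (m%n<n m n))))))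
                (cong (_+_ ⟦ m mod n ⟧) (pos-* (m / n) n))

  fromℤ : ℤ → Fin n
  fromℤ z = fromℕ< (n%ℕd<d z n)

  ⟦fromℤ⟧ : ∀ z → ⟦ fromℤ z ⟧ ≈ z
  ⟦fromℤ⟧ z = ≈-sym (subst (_≈ ⟦ fromℤ z ⟧) (sym z≡) (≈-+multiple ⟦ fromℤ z ⟧ (z /ℕ n)))
    where
    z≡ : z ≡ ⟦ fromℤ z ⟧ + (z /ℕ n) * + n
    z≡ = trans (a≡a%ℕn+[a/ℕn]*n z n) (cong (λ r → + r + (z /ℕ n) * + n) (sym (toℕ-fromℕ< (n%ℕd<d z n))))

  ⟦⟧-injective : ∀ {a b} → ⟦ a ⟧ ≈ ⟦ b ⟧ → a ≡ b
  ⟦⟧-injective {a} {b} (∣-diff (divides k a-b≡k*n)) =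
    toℕ-injective (+-injective (i-j≡0⇒i≡j ⟦ a ⟧ ⟦ b ⟧ (trans a-b≡k*n (cong (_* + n) k≡0))))
    where
    ∣a-b∣<n : ∣ ⟦ a ⟧ - ⟦ b ⟧ ∣ < n
    ∣a-b∣<n = subst (_< n) (cong ∣_∣ (sym ([+m]-[+n]≡m⊖n (toℕ a) (toℕ b))))
                (ℕ.≤-<-trans (∣m⊝n∣≤m⊔n (toℕ a) (toℕ b)) (ℕ.⊔-lub (toℕ<n a) (toℕ<n b)))
    k≡0 : k ≡ 0ℤ
    k≡0 = ∣k*d∣<d⇒k≡0 k n (subst (λ x → ∣ x ∣ < n) a-b≡k*n ∣a-b∣<n)

  lift-injective : ∀ {p q} → lift p ≈ᵥ lift q → p ≡ q
  lift-injective (a≈ , b≈) = cong₂ _,_ (⟦⟧-injective a≈) (⟦⟧-injective b≈)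

  fromℤ² : ℤ² → Pt n
  fromℤ² v = fromℤ (proj₁ v) , fromℤ (proj₂ v)

  lift-fromℤ² : ∀ v → lift (fromℤ² v) ≈ᵥ v
  lift-fromℤ² v = ⟦fromℤ⟧ (proj₁ v) , ⟦fromℤ⟧ (proj₂ v)

  lift-⊕ : ∀ p q → lift (p ⊕ q) ≈ᵥ lift p +ᵥ lift q
  lift-⊕ p q = ⟦mod⟧ _ , ⟦mod⟧ _

  lift-⊖ : ∀ p q → lift (p ⊖ q) ≈ᵥ lift p -ᵥ lift q
  lift-⊖ p q = ⟦⊖⟧ (proj₁ p) (proj₁ q) , ⟦⊖⟧ (proj₂ p) (proj₂ q)
    where
    ⟦⊖⟧ : ∀ a c → ⟦ (toℕ a ℕ.+ (n ∸ toℕ c)) mod n ⟧ ≈ ⟦ a ⟧ - ⟦ c ⟧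
    ⟦⊖⟧ a c = ≈-trans (⟦mod⟧ _) (subst (_≈ ⟦ a ⟧ - ⟦ c ⟧) (sym a+[n∸c]≡) (≈-+multiple (⟦ a ⟧ - ⟦ c ⟧) 1ℤ))
      where
      a+[n∸c]≡ : + (toℕ a ℕ.+ (n ∸ toℕ c)) ≡ ⟦ a ⟧ - ⟦ c ⟧ + 1ℤ * + n
      a+[n∸c]≡ = begin
        ⟦ a ⟧ + + (n ∸ toℕ c)         ≡⟨ cong (_+_ ⟦ a ⟧) (+[m∸n]≡+m-+n (ℕ.<⇒≤ (toℕ<n c))) ⟩
        ⟦ a ⟧ + (+ n - ⟦ c ⟧)          ≡⟨ identity ⟦ a ⟧ (+ n) ⟦ c ⟧ ⟩
        ⟦ a ⟧ - ⟦ c ⟧ + 1ℤ * + n       ∎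
        where
        open ≡-Reasoning
        identity : ∀ a n c → a + (n - c) ≡ a - c + 1ℤ * n
        identity = solve-∀

  ⊖-⊕ : ∀ z c → (z ⊖ c) ⊕ c ≡ z
  ⊖-⊕ z c = lift-injective (begin
    lift ((z ⊖ c) ⊕ c)         ≈⟨ lift-⊕ (z ⊖ c) c ⟩
    lift (z ⊖ c) +ᵥ lift c     ≈⟨ ≈ᵥ-+ᵥ (lift-⊖ z c) (≈ᵥ-refl {lift c}) ⟩
    lift z -ᵥ lift c +ᵥ lift c ≡⟨ cong₂ _,_ (identity ⟦ proj₁ z ⟧ ⟦ proj₁ c ⟧)
                                            (identity ⟦ proj₂ z ⟧ ⟦ proj₂ c ⟧) ⟩
    lift z                     ∎)
    where
    open ≈ᵥ-Reasoning
    identity : ∀ z c → z - c + c ≡ z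
    identity = solve-∀

  ⊕-⊖ : ∀ a c → (a ⊕ c) ⊖ c ≡ a
  ⊕-⊖ a c = lift-injective (begin
    lift ((a ⊕ c) ⊖ c)         ≈⟨ lift-⊖ (a ⊕ c) c ⟩
    lift (a ⊕ c) -ᵥ lift c     ≈⟨ ≈ᵥ--ᵥ (lift-⊕ a c) (≈ᵥ-refl {lift c}) ⟩
    lift a +ᵥ lift c -ᵥ lift c ≡⟨ cong₂ _,_ (identity ⟦ proj₁ a ⟧ ⟦ proj₁ c ⟧)
                                            (identity ⟦ proj₂ a ⟧ ⟦ proj₂ c ⟧) ⟩
    lift a                     ∎)
    where
    open ≈ᵥ-Reasoning
    identity : ∀ a c → a + c - c ≡ a
    identity = solve-∀

  Short : ℤ → Set
  Short r = ∣ r ∣ ℕ.+ ∣ r ∣ ≤ n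

  short-rep-minimal : ∀ {r r′} → r ≈ r′ → Short r′ → ∣ r′ ∣ ≤ ∣ r ∣
  short-rep-minimal {r} {r′} (∣-diff (divides k r-r′≡k*n)) short with k≡0⊎d≤∣k*d∣ k n
  ... | inj₁ refl      = ℕ.≤-reflexive (cong ∣_∣ (sym (i-j≡0⇒i≡j r r′ (trans r-r′≡k*n (*-zeroˡ (+ n))))))
  ... | inj₂ n≤∣k*n∣ = ℕ.+-cancelʳ-≤ (∣ r′ ∣) (∣ r′ ∣) (∣ r ∣) (begin
    ∣ r′ ∣ ℕ.+ ∣ r′ ∣ ≤⟨ short ⟩
    n                 ≤⟨ n≤∣k*n∣ ⟩
    ∣ k * + n ∣       ≡⟨ cong ∣_∣ r-r′≡k*n ⟨
    ∣ r - r′ ∣        ≤⟨ ∣i-j∣≤∣i∣+∣j∣ r r′ ⟩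
    ∣ r ∣ ℕ.+ ∣ r′ ∣  ∎)
    where open ℕ.≤-Reasoning

  leeEntry-rep : ∀ a → ∃[ r ] r ≈ ⟦ a ⟧ × ∣ r ∣ ≡ leeEntry a
  leeEntry-rep a with toℕ a ℕ.≤? n ∸ toℕ a
  ... | yes a≤n-a = ⟦ a ⟧ , ≈-refl , sym (ℕ.m≤n⇒m⊓n≡m a≤n-a)
  ... | no  a≰n-a = ⟦ a ⟧ - + n , a-n≈a , ∣a-n∣≡
    where
    a-n≈a : ⟦ a ⟧ - + n ≈ ⟦ a ⟧
    a-n≈a = subst (_≈ ⟦ a ⟧) (cong (_+_ ⟦ a ⟧) (-1*i≡-i (+ n))) (≈-+multiple ⟦ a ⟧ -1ℤ)
    ∣a-n∣≡ : ∣ ⟦ a ⟧ - + n ∣ ≡ leeEntry a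
    ∣a-n∣≡ = trans (cong ∣_∣ ([+m]-[+n]≡m⊖n (toℕ a) n))
                   (trans (∣⊖∣-< (toℕ<n a)) (sym (ℕ.m≥n⇒m⊓n≡n (ℕ.≰⇒≥ a≰n-a))))

  leeEntry-short : ∀ a → leeEntry a ℕ.+ leeEntry a ≤ n
  leeEntry-short a = ℕ.≤-trans (ℕ.+-mono-≤ (ℕ.m⊓n≤m (toℕ a) (n ∸ toℕ a)) (ℕ.m⊓n≤n (toℕ a) (n ∸ toℕ a)))
                               (ℕ.≤-reflexive (ℕ.m+[n∸m]≡n (ℕ.<⇒≤ (toℕ<n a))))

  leeEntry-≤ : ∀ {r a} → r ≈ ⟦ a ⟧ → leeEntry a ≤ ∣ r ∣
  leeEntry-≤ {r} {a} r≈a with leeEntry-rep a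
  ... | r₀ , r₀≈a , ∣r₀∣≡ = subst (_≤ ∣ r ∣) ∣r₀∣≡
    (short-rep-minimal (≈-trans r≈a (≈-sym r₀≈a)) (subst (λ x → x ℕ.+ x ≤ n) (sym ∣r₀∣≡) (leeEntry-short a)))

  leeEntry-≥ : ∀ {r a} → r ≈ ⟦ a ⟧ → Short r → ∣ r ∣ ≤ leeEntry a
  leeEntry-≥ {r} {a} r≈a short with leeEntry-rep a
  ... | r₀ , r₀≈a , ∣r₀∣≡ = subst (∣ r ∣ ≤_) ∣r₀∣≡ (short-rep-minimal (≈-trans r₀≈a (≈-sym r≈a)) short)

  dL-≤ : ∀ p q v → v ≈ᵥ lift p -ᵥ lift q → dL p q ≤ ‖ v ‖
  dL-≤ p q v (v₁≈ , v₂≈) = ℕ.+-mono-≤ (leeEntry-≤ (≈-trans v₁≈ (≈-sym (≈₁ (lift-⊖ p q)))))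
                                          (leeEntry-≤ (≈-trans v₂≈ (≈-sym (≈₂ (lift-⊖ p q)))))

  dL-≥ : ∀ p q v → v ≈ᵥ lift p -ᵥ lift q → Short (proj₁ v) → Short (proj₂ v) → ‖ v ‖ ≤ dL p q
  dL-≥ p q v (v₁≈ , v₂≈) short₁ short₂ =
    ℕ.+-mono-≤ (leeEntry-≥ (≈-trans v₁≈ (≈-sym (≈₁ (lift-⊖ p q)))) short₁)
               (leeEntry-≥ (≈-trans v₂≈ (≈-sym (≈₂ (lift-⊖ p q)))) short₂)

  dL-rep : ∀ p q → ∃[ v ] v ≈ᵥ lift p -ᵥ lift q × ‖ v ‖ ≡ dL p q
  dL-rep p q with leeEntry-rep (proj₁ (p ⊖ q)) | leeEntry-rep (proj₂ (p ⊖ q))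
  ... | r₁ , r₁≈ , ∣r₁∣≡ | r₂ , r₂≈ , ∣r₂∣≡ =
    (r₁ , r₂) ,
    (≈-trans r₁≈ (≈₁ (lift-⊖ p q)) , ≈-trans r₂≈ (≈₂ (lift-⊖ p q))) ,
    cong₂ ℕ._+_ ∣r₁∣≡ ∣r₂∣≡

  dL-self : ∀ p → dL p p ≡ 0
  dL-self p = ℕ.n≤0⇒n≡0 (dL-≤ p p (0ℤ , 0ℤ) (0≈a-a ⟦ proj₁ p ⟧ , 0≈a-a ⟦ proj₂ p ⟧))
    where
    0≈a-a : ∀ a → 0ℤ ≈ a - a
    0≈a-a a = ≈-reflexive (sym (+-inverseʳ a))

  dL-sym : ∀ p q → dL q p ≡ dL p q
  dL-sym p q = ℕ.≤-antisym (dL-sym-≤ p q) (dL-sym-≤ q p)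
    where
    flip : ∀ a b → - (a - b) ≡ b - a
    flip = solve-∀
    -ᵥ-≈ : ∀ p q v → v ≈ᵥ lift p -ᵥ lift q → -ᵥ v ≈ᵥ lift q -ᵥ lift p
    -ᵥ-≈ p q v (v₁≈ , v₂≈) = ≈-trans (≈-neg v₁≈) (≈-reflexive (flip ⟦ proj₁ p ⟧ ⟦ proj₁ q ⟧)) ,
                             ≈-trans (≈-neg v₂≈) (≈-reflexive (flip ⟦ proj₂ p ⟧ ⟦ proj₂ q ⟧))
    dL-sym-≤ : ∀ p q → dL q p ≤ dL p q
    dL-sym-≤ p q = subst (dL q p ≤_) (trans (‖-ᵥ‖ v) (proj₂ (proj₂ (dL-rep p q))))
                         (dL-≤ q p (-ᵥ v) (-ᵥ-≈ p q v (proj₁ (proj₂ (dL-rep p q)))))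
      where
      v : ℤ²
      v = proj₁ (dL-rep p q)

  dL-triangle : ∀ p q r → dL p r ≤ dL p q ℕ.+ dL q r
  dL-triangle p q r = ℕ.≤-trans (dL-≤ p r (v +ᵥ w) (+ᵥ-≈ v w (proj₁ (proj₂ (dL-rep p q))) (proj₁ (proj₂ (dL-rep q r)))))
                                (subst₂ (λ x y → ‖ v +ᵥ w ‖ ≤ x ℕ.+ y) (proj₂ (proj₂ (dL-rep p q)))
                                        (proj₂ (proj₂ (dL-rep q r))) (‖+ᵥ‖≤ v w))
    where
    v w : ℤ²
    v = proj₁ (dL-rep p q)
    w = proj₁ (dL-rep q r)
    telescope : ∀ a b c → (a - b) + (b - c) ≡ a - c
    telescope = solve-∀
    +ᵥ-≈ : ∀ v w → v ≈ᵥ lift p -ᵥ lift q → w ≈ᵥ lift q -ᵥ lift r → v +ᵥ w ≈ᵥ lift p -ᵥ lift r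
    +ᵥ-≈ v w (v₁≈ , v₂≈) (w₁≈ , w₂≈) =
      ≈-trans (≈-+ v₁≈ w₁≈) (≈-reflexive (telescope ⟦ proj₁ p ⟧ ⟦ proj₁ q ⟧ ⟦ proj₁ r ⟧)) ,
      ≈-trans (≈-+ v₂≈ w₂≈) (≈-reflexive (telescope ⟦ proj₂ p ⟧ ⟦ proj₂ q ⟧ ⟦ proj₂ r ⟧))

  dL-⊖ : ∀ z c c′ → dL (z ⊖ c′) (z ⊖ c) ≡ dL c c′
  dL-⊖ z c c′ = ℕ.≤-antisym (dL-via (z ⊖ c′) (z ⊖ c) c c′ (≈ᵥ-sym shift)) (dL-via c c′ (z ⊖ c′) (z ⊖ c) shift)
    where
    cancel : ∀ z c c′ → (z - c′) - (z - c) ≡ c - c′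
    cancel = solve-∀
    shift : lift (z ⊖ c′) -ᵥ lift (z ⊖ c) ≈ᵥ lift c -ᵥ lift c′
    shift = ≈ᵥ-trans (≈ᵥ--ᵥ (lift-⊖ z c′) (lift-⊖ z c))
                     (≈-reflexive (cancel ⟦ proj₁ z ⟧ ⟦ proj₁ c ⟧ ⟦ proj₁ c′ ⟧) ,
                      ≈-reflexive (cancel ⟦ proj₂ z ⟧ ⟦ proj₂ c ⟧ ⟦ proj₂ c′ ⟧))
    dL-via : ∀ p q p′ q′ → lift p′ -ᵥ lift q′ ≈ᵥ lift p -ᵥ lift q → dL p q ≤ dL p′ q′
    dL-via p q p′ q′ p′q′≈pq = subst (dL p q ≤_) (proj₂ (proj₂ (dL-rep p′ q′)))
                                 (dL-≤ p q _ (≈ᵥ-trans (proj₁ (proj₂ (dL-rep p′ q′))) p′q′≈pq))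

module Tiling (n : ℕ) .{{_ : NonZero n}} where

  open import Data.Nat using (_*_)
  open import Data.List using (List)
  open import Data.Bool using (Bool; true; false; if_then_else_)
  open import Data.Product using (_×_; _,_; ∃-syntax)
  open import Data.Empty using (⊥)
  open import Relation.Binary.PropositionalEquality
  open import Relation.Nullary using (¬_; contradiction)
  open FiniteSums
  open Residues n using (⊖-⊕; ⊕-⊖)
  open ≡-Reasoning

  𝟙 : Bool → ℕ
  𝟙 b = if b then 1 else 0

  private
    𝟙*𝟙≡0 : ∀ b b′ → (b ≡ true → b′ ≡ true → ⊥) → 𝟙 b * 𝟙 b′ ≡ 0
    𝟙*𝟙≡0 true  true  both = contradiction refl (both refl)
    𝟙*𝟙≡0 true  false _    = refl
    𝟙*𝟙≡0 false _     _    = refl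

  card-*-card : ∀ (C A : PtSet n) →
                (∀ z → ∃[ c ] c ∈ C × (z ⊖ c) ∈ A) →
                (∀ z {c c′} → c ∈ C → c′ ∈ C → (z ⊖ c) ∈ A → (z ⊖ c′) ∈ A → c ≡ c′) →
                card C * card A ≡ n * n
  card-*-card C A cover unique = begin
    card C * card A                                ≡⟨ ∑-*ʳ P (card A) (λ c → 𝟙 (C c)) ⟩
    ∑ P (λ c → 𝟙 (C c) * card A)                   ≡⟨ ∑-cong P (λ c → cong (𝟙 (C c) *_) (shift c)) ⟩
    ∑ P (λ c → 𝟙 (C c) * ∑ P (λ z → 𝟙 (A (z ⊖ c)))) ≡⟨ ∑-cong P (λ c → ∑-*ˡ P (𝟙 (C c)) (λ z → 𝟙 (A (z ⊖ c)))) ⟩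
    ∑ P (λ c → ∑ P (λ z → term z c))               ≡⟨ ∑-comm P P (λ c z → term z c) ⟩
    ∑ P (λ z → ∑ P (term z))                       ≡⟨ ∑-cong P exactly-one ⟩
    ∑ P (λ _ → 1)                                  ≡⟨ ∑-allPts-1 n ⟩
    n * n                                          ∎
    where
    P : List (Pt n)
    P = allPts n
    shift : ∀ c → card A ≡ ∑ P (λ z → 𝟙 (A (z ⊖ c)))
    shift c = ∑-allPts-reindex n (_⊕ c) (_⊖ c) (λ a → ⊕-⊖ a c) (λ z → ⊖-⊕ z c) (λ a → 𝟙 (A a))
    term : Pt n → Pt n → ℕ
    term z c = 𝟙 (C c) * 𝟙 (A (z ⊖ c))
    exactly-one : ∀ z → ∑ P (term z) ≡ 1
    exactly-one z with cover z
    ... | c₀ , c₀∈C , z⊖c₀∈A = trans (∑-allPts-δ n (term z) c₀ off-c₀) (cong₂ (λ b b′ → 𝟙 b * 𝟙 b′) c₀∈C z⊖c₀∈A)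
      where
      off-c₀ : ∀ c → ¬ c ≡ c₀ → term z c ≡ 0
      off-c₀ c c≢c₀ = 𝟙*𝟙≡0 (C c) (A (z ⊖ c)) (λ c∈C z⊖c∈A → c≢c₀ (unique z c∈C c₀∈C z⊖c∈A z⊖c₀∈A))

module CodeLattice (t : ℕ) where

  open import Data.Nat as ℕ using (suc)
  import Data.Nat.Properties as ℕ
  open import Data.Integer using (ℤ; +_; -[1+_]; _+_; _-_; -_; _*_; ∣_∣; 0ℤ; 1ℤ)
  open import Data.Integer.Properties using (pos-*)
  open import Data.Integer.Tactic.RingSolver using (solve-∀)
  open import Data.Product using (_×_; _,_; proj₁; proj₂; ∃-syntax)
  open import Data.Sum using (_⊎_)
  import Data.Sum as Sum
  open import Relation.Binary.PropositionalEquality using (_≡_; refl; sym; trans; cong; cong₂; subst; subst₂)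

  S : ℤ
  S = + suc t

  -- Λ I α β = (α - β)·(s + I, s - I) + β·(I, 2s - I), the span of the rows of G_i for I = i.
  Λ : ℤ → ℤ → ℤ → ℤ²
  Λ I α β = α * (S + I) - β * S , α * (S - I) + β * S

  +n≡[S+S]*S : + nOf t ≡ (S + S) * S
  +n≡[S+S]*S = trans (pos-* 2 (suc t ℕ.* suc t)) (trans (cong (+ 2 *_) (pos-* (suc t) (suc t))) (identity S))
    where
    identity : ∀ S → (1ℤ + 1ℤ) * (S * S) ≡ (S + S) * S
    identity = solve-∀

  Λ-+-nℤ² : ∀ I α β k l → Λ I α β +ᵥ (k * + nOf t , l * + nOf t) ≡ Λ I (α + (k + l) * S) (β + l * (S + I) - k * (S - I))
  Λ-+-nℤ² I α β k l = trans (cong (λ N → Λ I α β +ᵥ (k * N , l * N)) +n≡[S+S]*S)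
                             (cong₂ _,_ (identity₁ I α β k l S) (identity₂ I α β k l S))
    where
    identity₁ : ∀ I α β k l S → α * (S + I) - β * S + k * ((S + S) * S) ≡
                                (α + (k + l) * S) * (S + I) - (β + l * (S + I) - k * (S - I)) * S
    identity₁ = solve-∀
    identity₂ : ∀ I α β k l S → α * (S - I) + β * S + l * ((S + S) * S) ≡
                                (α + (k + l) * S) * (S - I) + (β + l * (S + I) - k * (S - I)) * S
    identity₂ = solve-∀

  -- In rotated coordinates Λ I α β is (2sα, 2sβ - 2Iα).
  Λ-short : ∀ I α β → ‖ Λ I α β ‖ ℕ.< suc t ℕ.+ suc t → Λ I α β ≡ (0ℤ , 0ℤ)
  Λ-short I α β short = subst₂ (λ α β → Λ I α β ≡ (0ℤ , 0ℤ)) (sym α≡0) (sym β≡0) refl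
    where
    sum≡ : ∀ α β I S → α * (S + I) - β * S + (α * (S - I) + β * S) ≡ α * (S + S)
    sum≡ = solve-∀
    difference≡ : ∀ β I S → 0ℤ * (S - I) + β * S - (0ℤ * (S + I) - β * S) ≡ β * (S + S)
    difference≡ = solve-∀
    α≡0 : α ≡ 0ℤ
    α≡0 = ∣k*d∣<d⇒k≡0 α (suc t ℕ.+ suc t)
      (ℕ.≤-<-trans (subst (λ x → ∣ x ∣ ℕ.≤ ‖ Λ I α β ‖) (sum≡ α β I S) (∣v₁+v₂∣≤‖v‖ (Λ I α β))) short)
    β≡0 : β ≡ 0ℤ
    β≡0 = ∣k*d∣<d⇒k≡0 β (suc t ℕ.+ suc t)
      (ℕ.≤-<-trans (subst (λ x → ∣ x ∣ ℕ.≤ ‖ Λ I 0ℤ β ‖) (difference≡ β I S) (∣v₂-v₁∣≤‖v‖ (Λ I 0ℤ β)))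
                   (subst (λ α → ‖ Λ I α β ‖ ℕ.< suc t ℕ.+ suc t) α≡0 short))

  Covered : ℤ → ℤ² → ℤ² → Set
  Covered I w e = ∃[ α ] ∃[ β ] (‖ w -ᵥ Λ I α β ‖ ℕ.≤ t ⊎ ‖ w -ᵥ e -ᵥ Λ I α β ‖ ℕ.≤ t)

  -- Choose α, then β, so that both rotated coordinates of the residual r lie in [-t, t + 1].
  covered-e₂ : ∀ I w → Covered I w (0ℤ , 1ℤ)
  covered-e₂ I w with window t (proj₁ w + proj₂ w)
  ... | α , ρ , ρ<2s , P≡ with window t (proj₂ w - proj₁ w + (I + I) * α)
  ... | β , ρ′ , ρ′<2s , Q≡ = α , β , Sum.map in-ball in-shifted-ball (window-pair t (proj₂ r) ρ<2s ρ′<2s parity)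
    where
    r : ℤ²
    r = w -ᵥ Λ I α β
    P-r : proj₁ r + proj₂ r ≡ + ρ - + t
    P-r = trans (identity (proj₁ w) (proj₂ w) α β I S) P≡
      where
      identity : ∀ u v α β I S → u - (α * (S + I) - β * S) + (v - (α * (S - I) + β * S)) ≡ u + v - α * (S + S)
      identity = solve-∀
    Q-r : proj₂ r - proj₁ r ≡ + ρ′ - + t
    Q-r = trans (identity (proj₁ w) (proj₂ w) α β I S) Q≡
      where
      identity : ∀ u v α β I S → v - (α * (S - I) + β * S) - (u - (α * (S + I) - β * S)) ≡ v - u + (I + I) * α - β * (S + S)
      identity = solve-∀
    parity : (+ ρ - + t) + (+ ρ′ - + t) ≡ proj₂ r + proj₂ r
    parity = trans (sym (cong₂ _+_ P-r Q-r)) (identity (proj₁ r) (proj₂ r))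
      where
      identity : ∀ a b → a + b + (b - a) ≡ b + b
      identity = solve-∀
    in-ball : ∣ + ρ - + t ∣ ℕ.≤ t × ∣ + ρ′ - + t ∣ ℕ.≤ t → ‖ r ‖ ℕ.≤ t
    in-ball (P-small , Q-small) = ‖‖≤-rotated t r (subst (λ x → ∣ x ∣ ℕ.≤ t) (sym P-r) P-small)
                                                  (subst (λ x → ∣ x ∣ ℕ.≤ t) (sym Q-r) Q-small)
    in-shifted-ball : ∣ + ρ - + t - 1ℤ ∣ ℕ.≤ t × ∣ + ρ′ - + t - 1ℤ ∣ ℕ.≤ t → ‖ w -ᵥ (0ℤ , 1ℤ) -ᵥ Λ I α β ‖ ℕ.≤ t
    in-shifted-ball (P-small , Q-small) = ‖‖≤-rotated t (w -ᵥ (0ℤ , 1ℤ) -ᵥ Λ I α β)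
      (subst (λ x → ∣ x ∣ ℕ.≤ t) (sym (trans (shiftP u v a b) (cong (_- 1ℤ) P-r))) P-small)
      (subst (λ x → ∣ x ∣ ℕ.≤ t) (sym (trans (shiftQ u v a b) (cong (_- 1ℤ) Q-r))) Q-small)
      where
      u v a b : ℤ
      u = proj₁ w
      v = proj₂ w
      a = proj₁ (Λ I α β)
      b = proj₂ (Λ I α β)
      shiftP : ∀ u v a b → u - 0ℤ - a + (v - 1ℤ - b) ≡ u - a + (v - b) - 1ℤ
      shiftP = solve-∀
      shiftQ : ∀ u v a b → v - 1ℤ - b - (u - 0ℤ - a) ≡ v - b - (u - a) - 1ℤ
      shiftQ = solve-∀

  -- Swapping coordinates maps Λ_{-I} onto Λ_I; this reduces covering for (1, 0) to covering for (0, 1).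
  Λ-neg : ∀ I α β → Λ (- I) α β ≡ swap (Λ I α (- β))
  Λ-neg I α β = cong₂ _,_ (identity₁ I α β S) (identity₂ I α β S)
    where
    identity₁ : ∀ I α β S → α * (S + - I) - β * S ≡ α * (S - I) + - β * S
    identity₁ = solve-∀
    identity₂ : ∀ I α β S → α * (S - - I) + β * S ≡ α * (S + I) - - β * S
    identity₂ = solve-∀

  covered-e₁ : ∀ I w → Covered I w (1ℤ , 0ℤ)
  covered-e₁ I w = unswap (covered-e₂ (- I) (swap w))
    where
    unswap : Covered (- I) (swap w) (0ℤ , 1ℤ) → Covered I w (1ℤ , 0ℤ)
    unswap (α , β , near) =
      α , - β , Sum.map (subst (ℕ._≤ t) (‖swap-Λ‖ w)) (subst (ℕ._≤ t) (‖swap-Λ‖ (w -ᵥ (1ℤ , 0ℤ)))) near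
      where
      ‖swap-Λ‖ : ∀ v → ‖ swap v -ᵥ Λ (- I) α β ‖ ≡ ‖ v -ᵥ Λ I α (- β) ‖
      ‖swap-Λ‖ v = trans (cong (λ x → ‖ swap v -ᵥ x ‖) (Λ-neg I α β)) (‖swap‖ (v -ᵥ Λ I α (- β)))

  covered-neg : ∀ I w e → Covered I (w +ᵥ e) e → Covered I w (-ᵥ e)
  covered-neg I w e (α , β , near) = α , β , Sum.swap (Sum.map (subst (λ x → ‖ x -ᵥ Λ I α β ‖ ℕ.≤ t) w+e≡w--e)
                                                                (subst (λ x → ‖ x -ᵥ Λ I α β ‖ ℕ.≤ t) w+e-e≡w) near)
    where
    w+e≡w--e : w +ᵥ e ≡ w -ᵥ (-ᵥ e)
    w+e≡w--e = cong₂ _,_ (identity (proj₁ w) (proj₁ e)) (identity (proj₂ w) (proj₂ e))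
      where
      identity : ∀ a b → a + b ≡ a - - b
      identity = solve-∀
    w+e-e≡w : w +ᵥ e -ᵥ e ≡ w
    w+e-e≡w = cong₂ _,_ (identity (proj₁ w) (proj₁ e)) (identity (proj₂ w) (proj₂ e))
      where
      identity : ∀ a b → a + b - b ≡ a
      identity = solve-∀

  covered : ∀ I w e → ‖ e ‖ ≡ 1 → Covered I w e
  covered I w (+ 0      , + 1)           _ = covered-e₂ I w
  covered I w (+ 1      , + 0)           _ = covered-e₁ I w
  covered I w (+ 0      , -[1+ 0 ])      _ = covered-neg I w (0ℤ , 1ℤ) (covered-e₂ I (w +ᵥ (0ℤ , 1ℤ)))
  covered I w (-[1+ 0 ] , + 0)           _ = covered-neg I w (1ℤ , 0ℤ) (covered-e₁ I (w +ᵥ (1ℤ , 0ℤ)))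
  covered I w (+ 0      , + 0)           ()
  covered I w (+ 0      , + suc (suc _)) ()
  covered I w (+ 0      , -[1+ suc _ ])  ()
  covered I w (+ 1      , + suc _)       ()
  covered I w (+ 1      , -[1+ _ ])      ()
  covered I w (+ suc (suc _) , _)        ()
  covered I w (-[1+ 0 ] , + suc _)       ()
  covered I w (-[1+ 0 ] , -[1+ _ ])      ()
  covered I w (-[1+ suc _ ] , _)         ()

module Membership where

  open import Data.Bool using (Bool; true; false; T; _∧_)
  open import Data.Bool.Properties using (T-≡)
  open import Data.Bool.ListAction using (any)
  open import Data.List.Relation.Unary.Any using (satisfied)
  import Data.List.Relation.Unary.Any as Any
  open import Data.List.Relation.Unary.Any.Properties using (any⁺; any⁻)
  open import Data.List.Membership.Propositional.Properties using (∈-cartesianProduct⁺; ∈-allFin)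
  open import Data.Product using (_×_; _,_; ∃-syntax)
  open import Function using (_∘_; Equivalence)
  open import Relation.Binary.PropositionalEquality using (_≡_; refl; subst)
  open import Relation.Nullary using (Dec)
  open import Relation.Nullary.Decidable using (⌊_⌋; toWitness; fromWitness)
  open Equivalence

  any-allPts⁺ : ∀ {n} (p : Pt n → Bool) a → p a ≡ true → any p (allPts n) ≡ true
  any-allPts⁺ p a pa = to T-≡ (any⁺ p (Any.map (λ a≡ → subst (T ∘ p) a≡ (from T-≡ pa))
                                               (∈-cartesianProduct⁺ (∈-allFin _) (∈-allFin _))))

  any-allPts⁻ : ∀ {n} (p : Pt n → Bool) → any p (allPts n) ≡ true → ∃[ a ] p a ≡ true
  any-allPts⁻ {n} p h with satisfied (any⁻ p (allPts n) (from T-≡ h))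
  ... | a , pa = a , to T-≡ pa

  ∧-true⁻ : ∀ a {b} → a ∧ b ≡ true → a ≡ true × b ≡ true
  ∧-true⁻ true  b≡true = refl , b≡true
  ∧-true⁻ false ()

  ⌊⌋⁺ : ∀ {P : Set} (d : Dec P) → P → ⌊ d ⌋ ≡ true
  ⌊⌋⁺ d = to T-≡ ∘ fromWitness

  ⌊⌋⁻ : ∀ {P : Set} (d : Dec P) → ⌊ d ⌋ ≡ true → P
  ⌊⌋⁻ d = toWitness ∘ from T-≡

module Sizes (t : ℕ) where

  open import Data.Nat as ℕ using (suc; _*_; _+_)
  import Data.Nat.Properties as ℕ
  open import Data.Nat.Tactic.RingSolver using (solve-∀)
  open import Data.Integer using (ℤ; ∣_∣)
  open import Relation.Binary.PropositionalEquality using (_≡_; sym; subst)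
  open Residues (nOf t) using (Short)

  ≤s²⇒Short : ∀ (r : ℤ) → ∣ r ∣ ≤ suc t * suc t → Short r
  ≤s²⇒Short r ∣r∣≤s² = ℕ.+-mono-≤ ∣r∣≤s² (subst (∣ r ∣ ≤_) (sym (ℕ.+-identityʳ (suc t * suc t))) ∣r∣≤s²)

  s+s≡2t+2 : suc t + suc t ≡ 2 * t + 2
  s+s≡2t+2 = identity t
    where
    identity : ∀ t → suc t + suc t ≡ 2 * t + 2
    identity = solve-∀

  t+s≡2t+1 : t + suc t ≡ 2 * t + 1
  t+s≡2t+1 = identity t
    where
    identity : ∀ t → t + suc t ≡ 2 * t + 1
    identity = solve-∀

module LinearCode (t i : ℕ) (i≤t : i ≤ t) (x : Pt (nOf t)) where

  open import Data.Nat as ℕ using (suc; _∸_; _<_)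
  import Data.Nat.Properties as ℕ
  open import Data.Nat.DivMod using (_mod_)
  open import Data.Integer using (ℤ; +_; _+_; _-_; -_; _*_; ∣_∣; 0ℤ; 1ℤ)
  open import Data.Integer.Properties using (pos-*)
  open import Data.Integer.Divisibility.Signed using (divides)
  open import Data.Integer.Tactic.RingSolver using (solve-∀)
  open import Data.Fin using (Fin; toℕ)
  open import Data.Product using (_,_; proj₁; proj₂; ∃-syntax)
  open import Data.Bool using (Bool; _∧_)
  open import Relation.Binary.PropositionalEquality
  open import Relation.Nullary.Decidable using (⌊_⌋)
  open import Function using (_∘_)
  open Sizes t
  open Congruence (nOf t)
  open Residues (nOf t)
  open CodeLattice t
  open Membership

  I : ℤ
  I = + i

  C : PtSet (nOf t)
  C = translate x (Ccode t i)

  generate : Fin (nOf t) → Fin (nOf t) → Pt (nOf t)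
  generate a b = ((toℕ a ℕ.* (suc t ℕ.+ i) ℕ.+ toℕ b ℕ.* i) mod nOf t) ,
                 ((toℕ a ℕ.* (suc t ∸ i) ℕ.+ toℕ b ℕ.* (2 ℕ.* suc t ∸ i)) mod nOf t)

  private
    +[s∸i]≡S-I : + (suc t ∸ i) ≡ S - I
    +[s∸i]≡S-I = +[m∸n]≡+m-+n (ℕ.m≤n⇒m≤1+n i≤t)

    +[2s∸i]≡S+S-I : + (2 ℕ.* suc t ∸ i) ≡ (S + S) - I
    +[2s∸i]≡S+S-I = trans (+[m∸n]≡+m-+n (ℕ.≤-trans (ℕ.m≤n⇒m≤1+n i≤t) (ℕ.m≤m+n (suc t) (suc t ℕ.+ 0))))
                          (cong (λ m → + (suc t ℕ.+ m) - I) (ℕ.+-identityʳ (suc t)))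

  lift-generate : ∀ a b → lift (generate a b) ≈ᵥ Λ I (⟦ a ⟧ + ⟦ b ⟧) ⟦ b ⟧
  lift-generate a b = ≈-trans (⟦mod⟧ _) (≈-reflexive first) , ≈-trans (⟦mod⟧ _) (≈-reflexive second)
    where
    first : + (toℕ a ℕ.* (suc t ℕ.+ i) ℕ.+ toℕ b ℕ.* i) ≡ (⟦ a ⟧ + ⟦ b ⟧) * (S + I) - ⟦ b ⟧ * S
    first = trans (cong₂ _+_ (pos-* (toℕ a) (suc t ℕ.+ i)) (pos-* (toℕ b) i)) (identity ⟦ a ⟧ ⟦ b ⟧ S I)
      where
      identity : ∀ a b S I → a * (S + I) + b * I ≡ (a + b) * (S + I) - b * S
      identity = solve-∀
    second : + (toℕ a ℕ.* (suc t ∸ i) ℕ.+ toℕ b ℕ.* (2 ℕ.* suc t ∸ i)) ≡ (⟦ a ⟧ + ⟦ b ⟧) * (S - I) + ⟦ b ⟧ * S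
    second = trans (cong₂ _+_ (trans (pos-* (toℕ a) (suc t ∸ i)) (cong (⟦ a ⟧ *_) +[s∸i]≡S-I))
                              (trans (pos-* (toℕ b) (2 ℕ.* suc t ∸ i)) (cong (⟦ b ⟧ *_) +[2s∸i]≡S+S-I)))
                   (identity ⟦ a ⟧ ⟦ b ⟧ S I)
      where
      identity : ∀ a b S I → a * (S - I) + b * ((S + S) - I) ≡ (a + b) * (S - I) + b * S
      identity = solve-∀

  Λ-cong : ∀ {α α′ β β′} → α ≈ α′ → β ≈ β′ → Λ I α β ≈ᵥ Λ I α′ β′
  Λ-cong α≈ β≈ = ≈-- (≈-*ʳ (S + I) α≈) (≈-*ʳ S β≈) , ≈-+ (≈-*ʳ (S - I) α≈) (≈-*ʳ S β≈)

  codeword : ℤ → ℤ → Pt (nOf t)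
  codeword α β = x ⊕ generate (fromℤ (α - β)) (fromℤ β)

  lift-codeword : ∀ α β → lift (codeword α β) ≈ᵥ lift x +ᵥ Λ I α β
  lift-codeword α β = begin
    lift (x ⊕ generate a b)             ≈⟨ lift-⊕ x (generate a b) ⟩
    lift x +ᵥ lift (generate a b)       ≈⟨ ≈ᵥ-+ᵥ (≈ᵥ-refl {lift x}) (lift-generate a b) ⟩
    lift x +ᵥ Λ I (⟦ a ⟧ + ⟦ b ⟧) ⟦ b ⟧ ≈⟨ ≈ᵥ-+ᵥ (≈ᵥ-refl {lift x}) (Λ-cong a+b≈α (⟦fromℤ⟧ β)) ⟩
    lift x +ᵥ Λ I α β                   ∎
    where
    open ≈ᵥ-Reasoning
    a b : Fin (nOf t)
    a = fromℤ (α - β)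
    b = fromℤ β
    a+b≈α : ⟦ a ⟧ + ⟦ b ⟧ ≈ α
    a+b≈α = ≈-trans (≈-+ (⟦fromℤ⟧ (α - β)) (⟦fromℤ⟧ β)) (≈-reflexive (identity α β))
      where
      identity : ∀ α β → α - β + β ≡ α
      identity = solve-∀

  private
    spans : Pt (nOf t) → Pt (nOf t) → Bool
    spans c ab = ⌊ c ≟P generate (proj₁ ab) (proj₂ ab) ⌋
    translates : Pt (nOf t) → Pt (nOf t) → Bool
    translates y c = Ccode t i c ∧ ⌊ y ≟P (x ⊕ c) ⌋

  codeword-∈ : ∀ α β → codeword α β ∈ C
  codeword-∈ α β = any-allPts⁺ (translates (codeword α β)) c (cong₂ _∧_ c∈Ccode (⌊⌋⁺ (codeword α β ≟P (x ⊕ c)) refl))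
    where
    c : Pt (nOf t)
    c = generate (fromℤ (α - β)) (fromℤ β)
    c∈Ccode : c ∈ Ccode t i
    c∈Ccode = any-allPts⁺ (spans c) (fromℤ (α - β) , fromℤ β) (⌊⌋⁺ (c ≟P c) refl)

  ∈C⇒lattice : ∀ {y} → y ∈ C → ∃[ α ] ∃[ β ] lift y ≈ᵥ lift x +ᵥ Λ I α β
  ∈C⇒lattice {y} y∈C with any-allPts⁻ (translates y) y∈C
  ... | c , c∈ with ∧-true⁻ (Ccode t i c) c∈
  ... | c∈Ccode , y≡x⊕c with any-allPts⁻ (spans c) c∈Ccode
  ... | (a , b) , c≡ab = ⟦ a ⟧ + ⟦ b ⟧ , ⟦ b ⟧ , (begin
    lift y                              ≡⟨ cong lift (⌊⌋⁻ (y ≟P (x ⊕ c)) y≡x⊕c) ⟩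
    lift (x ⊕ c)                        ≈⟨ lift-⊕ x c ⟩
    lift x +ᵥ lift c                    ≡⟨ cong (λ c → lift x +ᵥ lift c) (⌊⌋⁻ (c ≟P generate a b) c≡ab) ⟩
    lift x +ᵥ lift (generate a b)       ≈⟨ ≈ᵥ-+ᵥ (≈ᵥ-refl {lift x}) (lift-generate a b) ⟩
    lift x +ᵥ Λ I (⟦ a ⟧ + ⟦ b ⟧) ⟦ b ⟧ ∎)
    where open ≈ᵥ-Reasoning

  ≈Λ⇒≡Λ : ∀ v α β → v ≈ᵥ Λ I α β → ∃[ α′ ] ∃[ β′ ] v ≡ Λ I α′ β′
  ≈Λ⇒≡Λ v α β (∣-diff (divides k v₁-Λ₁≡) , ∣-diff (divides l v₂-Λ₂≡)) =
    α + (k + l) * S , β + l * (S + I) - k * (S - I) ,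
    trans (cong₂ _,_ (undo-difference v₁-Λ₁≡) (undo-difference v₂-Λ₂≡)) (Λ-+-nℤ² I α β k l)
    where
    undo-difference : ∀ {a b c} → a - b ≡ c → a ≡ b + c
    undo-difference {a} {b} refl = identity a b
      where
      identity : ∀ a b → a ≡ b + (a - b)
      identity = solve-∀

  ∈C-difference : ∀ {y y′} → y ∈ C → y′ ∈ C → ∃[ α ] ∃[ β ] lift y -ᵥ lift y′ ≈ᵥ Λ I α β
  ∈C-difference {y} {y′} y∈C y′∈C = difference (∈C⇒lattice y∈C) (∈C⇒lattice y′∈C)
    where
    difference : ∃[ α ] ∃[ β ] lift y ≈ᵥ lift x +ᵥ Λ I α β → ∃[ α ] ∃[ β ] lift y′ ≈ᵥ lift x +ᵥ Λ I α β →
                 ∃[ α ] ∃[ β ] lift y -ᵥ lift y′ ≈ᵥ Λ I α β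
    difference (α , β , y≈) (α′ , β′ , y′≈) = α - α′ , β - β′ , (begin
      lift y -ᵥ lift y′                            ≈⟨ ≈ᵥ--ᵥ y≈ y′≈ ⟩
      (lift x +ᵥ Λ I α β) -ᵥ (lift x +ᵥ Λ I α′ β′) ≡⟨ cong₂ _,_ (identity₁ ⟦ proj₁ x ⟧ α β α′ β′ I S)
                                                                (identity₂ ⟦ proj₂ x ⟧ α β α′ β′ I S) ⟩
      Λ I (α - α′) (β - β′)                        ∎)
      where
      open ≈ᵥ-Reasoning
      identity₁ : ∀ x α β α′ β′ I S →
                  x + (α * (S + I) - β * S) - (x + (α′ * (S + I) - β′ * S)) ≡ (α - α′) * (S + I) - (β - β′) * S
      identity₁ = solve-∀
      identity₂ : ∀ x α β α′ β′ I S →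
                  x + (α * (S - I) + β * S) - (x + (α′ * (S - I) + β′ * S)) ≡ (α - α′) * (S - I) + (β - β′) * S
      identity₂ = solve-∀

  dL<2s⇒≡ : ∀ {y y′} → y ∈ C → y′ ∈ C → dL y y′ < suc t ℕ.+ suc t → y ≡ y′
  dL<2s⇒≡ {y} {y′} y∈C y′∈C close = lift-injective (≈ᵥ-0⇒≈ᵥ (subst (_≈ᵥ lift y -ᵥ lift y′) v≡0 v≈))
    where
    v : ℤ²
    v = proj₁ (dL-rep y y′)
    v≈ : v ≈ᵥ lift y -ᵥ lift y′
    v≈ = proj₁ (proj₂ (dL-rep y y′))
    D : ∃[ α ] ∃[ β ] lift y -ᵥ lift y′ ≈ᵥ Λ I α β
    D = ∈C-difference y∈C y′∈C
    L : ∃[ α ] ∃[ β ] v ≡ Λ I α β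
    L = ≈Λ⇒≡Λ v (proj₁ D) (proj₁ (proj₂ D)) (≈ᵥ-trans v≈ (proj₂ (proj₂ D)))
    v≡0 : v ≡ (0ℤ , 0ℤ)
    v≡0 = trans (proj₂ (proj₂ L)) (Λ-short I (proj₁ L) (proj₁ (proj₂ L))
            (subst (_< suc t ℕ.+ suc t) (trans (sym (proj₂ (proj₂ (dL-rep y y′)))) (cong ‖_‖ (proj₂ (proj₂ L)))) close))

  private
    s+i≤s² : suc t ℕ.+ i ≤ suc t ℕ.* suc t
    s+i≤s² = ℕ.+-monoʳ-≤ (suc t) (ℕ.≤-trans i≤t (ℕ.m≤m*n t (suc t)))
    s∸i≤s² : suc t ∸ i ≤ suc t ℕ.* suc t
    s∸i≤s² = ℕ.≤-trans (ℕ.m∸n≤m (suc t) i) (ℕ.m≤m+n (suc t) (t ℕ.* suc t))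
    ∣S-I∣≡ : ∣ S - I ∣ ≡ suc t ∸ i
    ∣S-I∣≡ = cong ∣_∣ (sym +[s∸i]≡S-I)
    [s+i]+[s∸i]≡2t+2 : suc t ℕ.+ i ℕ.+ (suc t ∸ i) ≡ 2 ℕ.* t ℕ.+ 2
    [s+i]+[s∸i]≡2t+2 = trans (ℕ.+-assoc (suc t) i (suc t ∸ i))
                             (trans (cong (suc t ℕ.+_) (ℕ.m+[n∸m]≡n (ℕ.m≤n⇒m≤1+n i≤t))) s+s≡2t+2)

  -- The two codewords differ by the first row (s + i, s - i) of G_i.
  dL-codeword-1-0 : dL (codeword 1ℤ 0ℤ) (codeword 0ℤ 0ℤ) ≡ 2 ℕ.* t ℕ.+ 2
  dL-codeword-1-0 = ℕ.≤-antisym (subst (dL c₁ c₀ ≤_) ‖v‖≡ (dL-≤ c₁ c₀ v v≈))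
                                (subst (_≤ dL c₁ c₀) ‖v‖≡ (dL-≥ c₁ c₀ v v≈ short₁ short₂))
    where
    c₁ c₀ : Pt (nOf t)
    c₁ = codeword 1ℤ 0ℤ
    c₀ = codeword 0ℤ 0ℤ
    v : ℤ²
    v = S + I , S - I
    short₁ : Short (S + I)
    short₁ = ≤s²⇒Short (S + I) s+i≤s²
    short₂ : Short (S - I)
    short₂ = ≤s²⇒Short (S - I) (subst (_≤ suc t ℕ.* suc t) (sym ∣S-I∣≡) s∸i≤s²)
    v≈ : v ≈ᵥ lift c₁ -ᵥ lift c₀
    v≈ = ≈ᵥ-sym (begin
      lift c₁ -ᵥ lift c₀                             ≈⟨ ≈ᵥ--ᵥ (lift-codeword 1ℤ 0ℤ) (lift-codeword 0ℤ 0ℤ) ⟩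
      (lift x +ᵥ Λ I 1ℤ 0ℤ) -ᵥ (lift x +ᵥ Λ I 0ℤ 0ℤ) ≡⟨ cong₂ _,_ (identity₁ ⟦ proj₁ x ⟧ I S) (identity₂ ⟦ proj₂ x ⟧ I S) ⟩
      v                                              ∎)
      where
      open ≈ᵥ-Reasoning
      identity₁ : ∀ x I S → x + (1ℤ * (S + I) - 0ℤ * S) - (x + (0ℤ * (S + I) - 0ℤ * S)) ≡ S + I
      identity₁ = solve-∀
      identity₂ : ∀ x I S → x + (1ℤ * (S - I) + 0ℤ * S) - (x + (0ℤ * (S - I) + 0ℤ * S)) ≡ S - I
      identity₂ = solve-∀
    ‖v‖≡ : ‖ v ‖ ≡ 2 ℕ.* t ℕ.+ 2
    ‖v‖≡ = trans (cong (suc t ℕ.+ i ℕ.+_) ∣S-I∣≡) [s+i]+[s∸i]≡2t+2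

  minimum-distance : MinDistance C (2 ℕ.* t ℕ.+ 2)
  minimum-distance =
    (c₁ , c₀ , codeword-∈ 1ℤ 0ℤ , codeword-∈ 0ℤ 0ℤ , c₁≢c₀ , dL-codeword-1-0) ,
    λ y y′ y∈C y′∈C y≢y′ → subst (_≤ dL y y′) s+s≡2t+2 (ℕ.≮⇒≥ (y≢y′ ∘ dL<2s⇒≡ y∈C y′∈C))
    where
    c₁ c₀ : Pt (nOf t)
    c₁ = codeword 1ℤ 0ℤ
    c₀ = codeword 0ℤ 0ℤ
    c₁≢c₀ : c₁ ≢ c₀
    c₁≢c₀ c₁≡c₀ = ℕ.m+1+n≢0 (2 ℕ.* t) (trans (sym dL-codeword-1-0) (trans (cong (dL c₁) (sym c₁≡c₀)) (dL-self c₁)))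

module Anticode (t : ℕ) (p₁ p₂ : Pt (nOf t)) (p₁p₂≡1 : dL p₁ p₂ ≡ 1) where

  open import Data.Nat as ℕ using (suc; _≤ᵇ_)
  import Data.Nat.Properties as ℕ
  open import Data.Integer using (ℤ; +_; _+_; _-_; -_; _*_; ∣_∣; 1ℤ)
  open import Data.Integer.Properties using (∣i*j∣≡∣i∣*∣j∣)
  open import Data.Integer.Tactic.RingSolver using (solve-∀)
  open import Data.Bool using (true; false; _∨_)
  open import Data.Bool.Properties using (T-≡)
  open import Data.Product using (_×_; _,_; proj₁; proj₂; ∃-syntax)
  open import Data.Sum using (_⊎_; inj₁; inj₂)
  open import Function using (Equivalence)
  open import Relation.Binary.PropositionalEquality
  open Congruence (nOf t)
  open Residues (nOf t)
  open Sizes t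
  open Equivalence using (to; from)

  A : PtSet (nOf t)
  A = Acore t p₁ p₂

  ∈A⁺ : ∀ a → dL a p₁ ≤ t ⊎ dL a p₂ ≤ t → a ∈ A
  ∈A⁺ a (inj₁ near₁) = cong (_∨ (dL a p₂ ≤ᵇ t)) (to T-≡ (ℕ.≤⇒≤ᵇ near₁))
  ∈A⁺ a (inj₂ near₂) = trans (cong ((dL a p₁ ≤ᵇ t) ∨_) (to T-≡ (ℕ.≤⇒≤ᵇ near₂))) (Data.Bool.Properties.∨-zeroʳ _)
    where import Data.Bool.Properties

  ∈A⁻ : ∀ a → a ∈ A → dL a p₁ ≤ t ⊎ dL a p₂ ≤ t
  ∈A⁻ a a∈A with dL a p₁ ≤ᵇ t in near₁
  ... | true  = inj₁ (ℕ.≤ᵇ⇒≤ _ t (from T-≡ near₁))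
  ... | false = inj₂ (ℕ.≤ᵇ⇒≤ _ t (from T-≡ a∈A))

  private
    near-pair : ∀ a b q q′ → dL a q ≤ t → dL q q′ ≤ 1 → dL b q′ ≤ t → dL a b ≤ t ℕ.+ suc t
    near-pair a b q q′ aq≤t qq′≤1 bq′≤t = ℕ.≤-trans (dL-triangle a q b)
      (ℕ.+-mono-≤ aq≤t (ℕ.≤-trans (dL-triangle q q′ b) (ℕ.+-mono-≤ qq′≤1 (subst (_≤ t) (sym (dL-sym b q′)) bq′≤t))))

    core-close : ∀ {q q′} → (q ≡ p₁ ⊎ q ≡ p₂) → (q′ ≡ p₁ ⊎ q′ ≡ p₂) → dL q q′ ≤ 1
    core-close (inj₁ refl) (inj₁ refl) = subst (_≤ 1) (sym (dL-self p₁)) ℕ.z≤n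
    core-close (inj₁ refl) (inj₂ refl) = ℕ.≤-reflexive p₁p₂≡1
    core-close (inj₂ refl) (inj₁ refl) = ℕ.≤-reflexive (trans (dL-sym p₁ p₂) p₁p₂≡1)
    core-close (inj₂ refl) (inj₂ refl) = subst (_≤ 1) (sym (dL-self p₂)) ℕ.z≤n

    near-core : ∀ a → a ∈ A → ∃[ q ] (q ≡ p₁ ⊎ q ≡ p₂) × dL a q ≤ t
    near-core a a∈A with ∈A⁻ a a∈A
    ... | inj₁ near₁ = p₁ , inj₁ refl , near₁
    ... | inj₂ near₂ = p₂ , inj₂ refl , near₂

  A-diameter≤ : ∀ a b → a ∈ A → b ∈ A → dL a b ≤ t ℕ.+ suc t
  A-diameter≤ a b a∈A b∈A =
    near-pair a b (proj₁ Q) (proj₁ Q′) (proj₂ (proj₂ Q))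
              (core-close (proj₁ (proj₂ Q)) (proj₁ (proj₂ Q′))) (proj₂ (proj₂ Q′))
    where
    Q : ∃[ q ] (q ≡ p₁ ⊎ q ≡ p₂) × dL a q ≤ t
    Q′ : ∃[ q ] (q ≡ p₁ ⊎ q ≡ p₂) × dL b q ≤ t
    Q = near-core a a∈A
    Q′ = near-core b b∈A

  private
    r : ℤ²
    r = proj₁ (dL-rep p₁ p₂)
    r≈ : r ≈ᵥ lift p₁ -ᵥ lift p₂
    r≈ = proj₁ (proj₂ (dL-rep p₁ p₂))
    ‖r‖≡1 : ‖ r ‖ ≡ 1
    ‖r‖≡1 = trans (proj₂ (proj₂ (dL-rep p₁ p₂))) p₁p₂≡1
    T : ℤ
    T = + t

    -- The ends of a path of length 2t + 1 through the core, in the direction r = p₁ - p₂.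
    end₁ end₂ : Pt (nOf t)
    end₁ = fromℤ² (lift p₁ +ᵥ T *ᵥ r)
    end₂ = fromℤ² (lift p₂ -ᵥ T *ᵥ r)

    end₁-p₁ : T *ᵥ r ≈ᵥ lift end₁ -ᵥ lift p₁
    end₁-p₁ = ≈ᵥ-sym (≈ᵥ-trans (≈ᵥ--ᵥ (lift-fromℤ² (lift p₁ +ᵥ T *ᵥ r)) (≈ᵥ-refl {lift p₁}))
                               (≈-reflexive (cancel ⟦ proj₁ p₁ ⟧ (T * proj₁ r)) , ≈-reflexive (cancel ⟦ proj₂ p₁ ⟧ (T * proj₂ r))))
      where
      cancel : ∀ p u → p + u - p ≡ u
      cancel = solve-∀

    end₂-p₂ : -ᵥ (T *ᵥ r) ≈ᵥ lift end₂ -ᵥ lift p₂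
    end₂-p₂ = ≈ᵥ-sym (≈ᵥ-trans (≈ᵥ--ᵥ (lift-fromℤ² (lift p₂ -ᵥ T *ᵥ r)) (≈ᵥ-refl {lift p₂}))
                               (≈-reflexive (cancel ⟦ proj₁ p₂ ⟧ (T * proj₁ r)) , ≈-reflexive (cancel ⟦ proj₂ p₂ ⟧ (T * proj₂ r))))
      where
      cancel : ∀ p u → p - u - p ≡ - u
      cancel = solve-∀

    end₁-end₂ : (1ℤ + (T + T)) *ᵥ r ≈ᵥ lift end₁ -ᵥ lift end₂
    end₁-end₂ = ≈ᵥ-sym (begin
      lift end₁ -ᵥ lift end₂                     ≈⟨ ≈ᵥ--ᵥ (lift-fromℤ² (lift p₁ +ᵥ T *ᵥ r)) (lift-fromℤ² (lift p₂ -ᵥ T *ᵥ r)) ⟩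
      (lift p₁ +ᵥ T *ᵥ r) -ᵥ (lift p₂ -ᵥ T *ᵥ r) ≡⟨ cong₂ _,_ (regroup ⟦ proj₁ p₁ ⟧ ⟦ proj₁ p₂ ⟧ (proj₁ r) T)
                                                              (regroup ⟦ proj₂ p₁ ⟧ ⟦ proj₂ p₂ ⟧ (proj₂ r) T) ⟩
      (lift p₁ -ᵥ lift p₂) +ᵥ (T + T) *ᵥ r       ≈⟨ ≈ᵥ-+ᵥ (≈ᵥ-sym r≈) (≈ᵥ-refl {(T + T) *ᵥ r}) ⟩
      r +ᵥ (T + T) *ᵥ r                          ≡⟨ cong₂ _,_ (collect (proj₁ r) T) (collect (proj₂ r) T) ⟩
      (1ℤ + (T + T)) *ᵥ r                        ∎)
      where
      open ≈ᵥ-Reasoning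
      regroup : ∀ p q a T → p + T * a - (q - T * a) ≡ p - q + (T + T) * a
      regroup = solve-∀
      collect : ∀ a T → a + (T + T) * a ≡ (1ℤ + (T + T)) * a
      collect = solve-∀

    ‖T*r‖≡t : ‖ T *ᵥ r ‖ ≡ t
    ‖T*r‖≡t = trans (‖*ᵥ‖ T r) (trans (cong (t ℕ.*_) ‖r‖≡1) (ℕ.*-identityʳ t))

    ‖[2t+1]*r‖≡ : ‖ (1ℤ + (T + T)) *ᵥ r ‖ ≡ t ℕ.+ suc t
    ‖[2t+1]*r‖≡ = trans (‖*ᵥ‖ (1ℤ + (T + T)) r)
                        (trans (cong (suc (t ℕ.+ t) ℕ.*_) ‖r‖≡1) (trans (ℕ.*-identityʳ _) (sym (ℕ.+-suc t t))))

    short : ∀ a → ∣ a ∣ ≤ 1 → Short ((1ℤ + (T + T)) * a)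
    short a ∣a∣≤1 = ≤s²⇒Short ((1ℤ + (T + T)) * a) (begin
      ∣ (1ℤ + (T + T)) * a ∣   ≡⟨ ∣i*j∣≡∣i∣*∣j∣ (1ℤ + (T + T)) a ⟩
      suc (t ℕ.+ t) ℕ.* ∣ a ∣ ≤⟨ ℕ.*-monoʳ-≤ (suc (t ℕ.+ t)) ∣a∣≤1 ⟩
      suc (t ℕ.+ t) ℕ.* 1     ≡⟨ ℕ.*-identityʳ _ ⟩
      suc (t ℕ.+ t)           ≤⟨ ℕ.s≤s (ℕ.+-monoʳ-≤ t (ℕ.m≤m*n t (suc t))) ⟩
      suc t ℕ.* suc t         ∎)
      where open ℕ.≤-Reasoning

    end₁-near : dL end₁ p₁ ≤ t
    end₁-near = subst (dL end₁ p₁ ≤_) ‖T*r‖≡t (dL-≤ end₁ p₁ (T *ᵥ r) end₁-p₁)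

    end₂-near : dL end₂ p₂ ≤ t
    end₂-near = subst (dL end₂ p₂ ≤_) (trans (‖-ᵥ‖ (T *ᵥ r)) ‖T*r‖≡t) (dL-≤ end₂ p₂ (-ᵥ (T *ᵥ r)) end₂-p₂)

    dL-ends : dL end₁ end₂ ≡ t ℕ.+ suc t
    dL-ends = ℕ.≤-antisym (A-diameter≤ end₁ end₂ (∈A⁺ end₁ (inj₁ end₁-near)) (∈A⁺ end₂ (inj₂ end₂-near)))
      (subst (_≤ dL end₁ end₂) ‖[2t+1]*r‖≡
        (dL-≥ end₁ end₂ _ end₁-end₂ (short (proj₁ r) (subst (∣ proj₁ r ∣ ≤_) ‖r‖≡1 (ℕ.m≤m+n _ _)))
                                     (short (proj₂ r) (subst (∣ proj₂ r ∣ ≤_) ‖r‖≡1 (ℕ.m≤n+m _ _)))))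

  anticode : IsAnticode A (2 ℕ.* t ℕ.+ 1)
  anticode = (end₁ , end₂ , ∈A⁺ end₁ (inj₁ end₁-near) , ∈A⁺ end₂ (inj₂ end₂-near) , trans dL-ends t+s≡2t+1) ,
             λ a b a∈A b∈A → subst (dL a b ≤_) t+s≡2t+1 (A-diameter≤ a b a∈A b∈A)

module Decomposition (t i : ℕ) (i≤t : i ≤ t) (x p₁ p₂ : Pt (nOf t)) (p₁p₂≡1 : dL p₁ p₂ ≡ 1) where

  open import Data.Nat as ℕ using (suc)
  import Data.Nat.Properties as ℕ
  open import Data.Integer using (ℤ; _+_; _-_)
  open import Data.Integer.Tactic.RingSolver using (solve-∀)
  open import Data.Product using (_×_; _,_; proj₁; proj₂; ∃-syntax)
  import Data.Sum as Sum
  open import Relation.Binary.PropositionalEquality using (trans; cong₂)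
  open import Defs using (_⊖_; _∈_)
  open Congruence (nOf t)
  open Residues (nOf t)
  open CodeLattice t
  open LinearCode t i i≤t x
  open Anticode t p₁ p₂ p₁p₂≡1

  residual : ∀ z α β p u → u ≈ᵥ lift z -ᵥ lift x -ᵥ lift p → u -ᵥ Λ I α β ≈ᵥ lift (z ⊖ codeword α β) -ᵥ lift p
  residual z α β p u u≈ = begin
    u -ᵥ Λ I α β                                   ≈⟨ ≈ᵥ--ᵥ u≈ (≈ᵥ-refl {Λ I α β}) ⟩
    lift z -ᵥ lift x -ᵥ lift p -ᵥ Λ I α β          ≡⟨ cong₂ _,_ (regroup ⟦ proj₁ z ⟧ ⟦ proj₁ x ⟧ ⟦ proj₁ p ⟧ (proj₁ (Λ I α β)))
                                                                (regroup ⟦ proj₂ z ⟧ ⟦ proj₂ x ⟧ ⟦ proj₂ p ⟧ (proj₂ (Λ I α β))) ⟩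
    lift z -ᵥ (lift x +ᵥ Λ I α β) -ᵥ lift p        ≈⟨ ≈ᵥ--ᵥ (≈ᵥ--ᵥ (≈ᵥ-refl {lift z}) (≈ᵥ-sym (lift-codeword α β)))
                                                             (≈ᵥ-refl {lift p}) ⟩
    lift z -ᵥ lift (codeword α β) -ᵥ lift p        ≈⟨ ≈ᵥ--ᵥ (≈ᵥ-sym (lift-⊖ z (codeword α β))) (≈ᵥ-refl {lift p}) ⟩
    lift (z ⊖ codeword α β) -ᵥ lift p              ∎
    where
    open ≈ᵥ-Reasoning
    regroup : ∀ z x p l → z - x - p - l ≡ z - (x + l) - p
    regroup = solve-∀

  -- Covering w = z - x - p₁ in the direction e = p₂ - p₁ puts z ⊖ c within t of p₁ or of p₂.
  decomposition-exists : ∀ z → ∃[ c ] c ∈ C × (z ⊖ c) ∈ A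
  decomposition-exists z = codeword α β , codeword-∈ α β , ∈A⁺ (z ⊖ codeword α β) (Sum.map near₁ near₂ (proj₂ (proj₂ K)))
    where
    w e : ℤ²
    w = lift z -ᵥ lift x -ᵥ lift p₁
    e = proj₁ (dL-rep p₂ p₁)
    e≈ : e ≈ᵥ lift p₂ -ᵥ lift p₁
    e≈ = proj₁ (proj₂ (dL-rep p₂ p₁))
    K : Covered I w e
    K = covered I w e (trans (proj₂ (proj₂ (dL-rep p₂ p₁))) (trans (dL-sym p₁ p₂) p₁p₂≡1))
    α β : ℤ
    α = proj₁ K
    β = proj₁ (proj₂ K)
    near₁ : ‖ w -ᵥ Λ I α β ‖ ≤ t → dL (z ⊖ codeword α β) p₁ ≤ t
    near₁ = ℕ.≤-trans (dL-≤ (z ⊖ codeword α β) p₁ (w -ᵥ Λ I α β) (residual z α β p₁ w (≈ᵥ-refl {w})))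
    w-e≈ : w -ᵥ e ≈ᵥ lift z -ᵥ lift x -ᵥ lift p₂
    w-e≈ = ≈ᵥ-trans (≈ᵥ--ᵥ (≈ᵥ-refl {w}) e≈)
                    (≈-reflexive (cancel ⟦ proj₁ z ⟧ ⟦ proj₁ x ⟧ ⟦ proj₁ p₁ ⟧ ⟦ proj₁ p₂ ⟧) ,
                     ≈-reflexive (cancel ⟦ proj₂ z ⟧ ⟦ proj₂ x ⟧ ⟦ proj₂ p₁ ⟧ ⟦ proj₂ p₂ ⟧))
      where
      cancel : ∀ z x p q → z - x - p - (q - p) ≡ z - x - q
      cancel = solve-∀
    near₂ : ‖ w -ᵥ e -ᵥ Λ I α β ‖ ≤ t → dL (z ⊖ codeword α β) p₂ ≤ t
    near₂ = ℕ.≤-trans (dL-≤ (z ⊖ codeword α β) p₂ (w -ᵥ e -ᵥ Λ I α β) (residual z α β p₂ (w -ᵥ e) w-e≈))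

  decomposition-unique : ∀ z {c c′} → c ∈ C → c′ ∈ C → (z ⊖ c) ∈ A → (z ⊖ c′) ∈ A → c ≡ c′
  decomposition-unique z {c} {c′} c∈C c′∈C z⊖c∈A z⊖c′∈A = dL<2s⇒≡ c∈C c′∈C (begin-strict
    dL c c′               ≡⟨ dL-⊖ z c c′ ⟨
    dL (z ⊖ c′) (z ⊖ c)   ≤⟨ A-diameter≤ (z ⊖ c′) (z ⊖ c) z⊖c′∈A z⊖c∈A ⟩
    t ℕ.+ suc t           <⟨ ℕ.n<1+n (t ℕ.+ suc t) ⟩
    suc t ℕ.+ suc t       ∎)
    where open ℕ.≤-Reasoning

open import Data.Nat using (_+_; _*_; _∸_)
open import Data.Nat.Properties using (+-suc)
open import Data.Product using (_,_)
open import Relation.Binary.PropositionalEquality using (sym; cong)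

proposition1 : (t : ℕ) → 1 ≤ t → (i : ℕ) → i ≤ t → (x : Pt (nOf t)) →
    (p₁ p₂ : Pt (nOf t)) → dL p₁ p₂ ≡ 1 →
    DiameterPerfect (translate x (Ccode t i)) (2 * t + 1) (2 * t + 2) (Acore t p₁ p₂)
proposition1 t _ i i≤t x p₁ p₂ p₁p₂≡1 =
  minimum-distance , sym (cong (_∸ 1) (+-suc (2 * t) 1)) , anticode ,
  card-*-card C A decomposition-exists decomposition-unique
  where
  open LinearCode t i i≤t x
  open Anticode t p₁ p₂ p₁p₂≡1
  open Tiling (nOf t)
  open Decomposition t i i≤t x p₁ p₂ p₁p₂≡1
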